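{- For every non-commutative arithmetic formula $\Phi$ of size $s$ over a field $\mathbb{F}$ computing a polynomial $f$ in non-commuting variables $x_1,\dots,x_n$, there is a directed graph $G$ on $N\le \mathrm{poly}(s)$ vertices with a distinguished vertex $v_1$, whose edges are weighted by variables among $x_1,\dots,x_n$ or constants of $\mathbb{F}$, such that $f=\mathsf{HC}(G)$.
   Context: For a directed graph $G$ on vertex set $\{v_1,\dots,v_N\}$ with edge weights $w(u,v)$ in the free algebra $\mathbb{F}\langle x_1,\dots,x_n\rangle$, define $\mathsf{HC}(G)=\sum w(v_1,u_1)\,w(u_1,u_2)\cdots w(u_{N-1},v_1)$, the sum over all directed Hamiltonian cycles $v_1\to u_1\to\cdots\to u_{N-1}\to v_1$ of $G$, each weight product taken in the traversal order starting at $v_1$. Equivalently, $\mathsf{HC}(G)$ is the non-commutative Hamiltonian cycle polynomial $\sum_{\sigma}x_{1,\sigma(1)}x_{\sigma(1),\sigma^2(1)}\cdots x_{\sigma^{N-1}(1),1}$ (over $N$-cycles $\sigma$) with $x_{i,j}$ replaced by $w(v_i,v_j)$ (and by $0$ for non-edges). Size of a formula is its number of gates. -}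

module Defs where

open import Level using (Level; _⊔_)
open import Algebra.Bundles using (CommutativeRing)
open import Data.Nat as ℕ using (ℕ; zero; suc)
open import Data.Fin as Fin using (Fin; zero; suc)
open import Data.Fin.Properties as FinP using ()
open import Data.List as List using (List; []; _∷_; _++_; concatMap; map; foldr)
open import Data.List.Properties using (≡-dec)
open import Data.Maybe using (Maybe; just; nothing)
open import Data.Product using (_×_; _,_; ∃)
open import Relation.Nullary using (¬_; yes; no)
open import Relation.Binary.PropositionalEquality using (_≡_)

record Field (c ℓ : Level) : Set (Level.suc (c ⊔ ℓ)) where
  field
    commutativeRing : CommutativeRing c ℓ
  open CommutativeRing commutativeRing public
  field
    1≉0     : ¬ (1# ≈ 0#)
    inverse : ∀ x → ¬ (x ≈ 0#) → ∃ λ y → x * y ≈ 1#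

module NC {c ℓ : Level} (F : Field c ℓ) (n : ℕ) where
  open Field F using (Carrier; _≈_; _+_; _*_; 0#; 1#)

  Word : Set
  Word = List (Fin n)

  -- A non-commutative polynomial, given as a finite formal sum of terms (coefficient, word).
  NCPoly : Set c
  NCPoly = List (Carrier × Word)

  0ₚ : NCPoly
  0ₚ = []

  constₚ : Carrier → NCPoly
  constₚ a = (a , []) ∷ []

  varₚ : Fin n → NCPoly
  varₚ i = (1# , i ∷ []) ∷ []

  _+ₚ_ : NCPoly → NCPoly → NCPoly
  p +ₚ q = p ++ q

  _*ₚ_ : NCPoly → NCPoly → NCPoly
  p *ₚ q = concatMap (λ { (a , u) → map (λ { (b , v) → (a * b , u ++ v) }) q }) p

  coeff : NCPoly → Word → Carrier
  coeff [] w = 0#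
  coeff ((a , u) ∷ p) w with ≡-dec Fin._≟_ u w
  ... | yes _ = a + coeff p w
  ... | no  _ = coeff p w

  _≈ₚ_ : NCPoly → NCPoly → Set ℓ
  p ≈ₚ q = ∀ w → coeff p w ≈ coeff q w

  data Formula : Set c where
    var  : Fin n → Formula
    cst  : Carrier → Formula
    _⊕_  : Formula → Formula → Formula
    _⊗_  : Formula → Formula → Formula

  size : Formula → ℕ
  size (var _) = 1
  size (cst _) = 1
  size (φ ⊕ ψ) = suc (size φ ℕ.+ size ψ)
  size (φ ⊗ ψ) = suc (size φ ℕ.+ size ψ)

  eval : Formula → NCPoly
  eval (var i) = varₚ i
  eval (cst a) = constₚ a
  eval (φ ⊕ ψ) = eval φ +ₚ eval ψ
  eval (φ ⊗ ψ) = eval φ *ₚ eval ψ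

  data Label : Set c where
    lvar : Fin n → Label
    lcst : Carrier → Label

  labelPoly : Label → NCPoly
  labelPoly (lvar i) = varₚ i
  labelPoly (lcst a) = constₚ a

  -- A weighted directed graph on vertex set Fin N: nothing = non-edge.
  -- The distinguished vertex v₁ is `zero` (so N = suc m).
  Graph : ℕ → Set c
  Graph N = Fin N → Fin N → Maybe Label

  weight : ∀ {N} → Graph N → Fin N → Fin N → NCPoly
  weight G u v with G u v
  ... | just l  = labelPoly l
  ... | nothing = 0ₚ

  insertions : {A : Set} → A → List A → List (List A)
  insertions x [] = (x ∷ []) ∷ []
  insertions x (y ∷ ys) = (x ∷ y ∷ ys) ∷ map (y ∷_) (insertions x ys)

  orderings : {A : Set} → List A → List (List A)
  orderings [] = [] ∷ []
  orderings (x ∷ xs) = concatMap (insertions x) (orderings xs)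

  sumₚ : List NCPoly → NCPoly
  sumₚ = foldr _+ₚ_ 0ₚ

  walk : ∀ {m} → Graph (suc m) → Fin (suc m) → List (Fin (suc m)) → NCPoly
  walk G u [] = weight G u Fin.zero
  walk G u (v ∷ vs) = weight G u v *ₚ walk G v vs

  -- HC(G) = Σ over Hamiltonian cycles v₁ → u₁ → ⋯ → u_{N-1} → v₁ of the weight product.
  HC : ∀ {m} → Graph (suc m) → NCPoly
  HC {m} G = sumₚ (map (walk G Fin.zero) (orderings (map Fin.suc (List.allFin m))))

{-# OPTIONS --safe #-}
-- Compile Φ into an algebraic branching program: W × W matrices M₀ … M_{L-1} with entries variables,
-- constants or 0, whose product has (0 , 0) entry f. A leaf is a 1 × 1 program, a product runs the
-- two programs one after the other, and a sum runs them side by side, block-diagonally, between a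
-- layer splitting row 0 into two rows and a layer merging two columns into column 0; so L = 2 · size
-- and W ≤ size. Then, as in Valiant's construction, every layer becomes a directed cycle of W
-- vertices with unit weights, and the edge from position p of layer l to position q of layer l + 1
-- carries the entry (next p , q) of M_l, the last layer leading back to the start vertex (0 , 0).
-- A Hamiltonian cycle entering a layer at position k is forced around the whole layer, since every
-- vertex has a single in-edge from the vertices not yet visited; it leaves from the predecessor of
-- k and so reads row k. Summing over the entry points layer by layer gives HC(G) = f, on L · W ≤
-- 2 · size² vertices.
module Submission where

open import Defs
open import Level using (Level)
open import Data.Nat using (ℕ; suc; _≤_; _*_; _^_)
open import Data.Product using (Σ; ∃; _×_; _,_)

open import Algebra.Bundles using (CommutativeMonoid)
import Algebra.Properties.CommutativeSemigroup as CommutativeSemigroupProperties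
open import Algebra.Structures using (IsCommutativeMonoid)
open import Data.Bool using (if_then_else_; _∧_; _∨_; not)
open import Data.Bool.Properties using (∨-zeroʳ; ∧-zeroʳ)
open import Data.Empty using (⊥-elim)
open import Data.Fin as Fin using (Fin)
open import Data.List as List using (List; []; _∷_; _++_; map; concatMap; foldr; length)
import Data.List.Properties as Listₚ
open import Data.List.Membership.Propositional using (_∈_)
open import Data.List.Relation.Binary.Permutation.Propositional as ↭
  using (_↭_; ↭-refl; ↭-sym; ↭-trans; ↭-prep; ↭-swap; ↭-reflexive; ↭⇒↭ₛ; ↭⇒↭ₛ′)
  renaming (module PermutationReasoning to ↭-Reasoning)
open import Data.List.Relation.Binary.Permutation.Propositional.Properties
  using (++⁺ˡ; ++⁺ʳ; ++⁺; ++-comm; shifts; map⁺; drop-∷; ↭-empty-inv; ↭-length; All-resp-↭; ∈-resp-↭)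
import Data.List.Relation.Binary.Permutation.Setoid.Properties as Permutationₛ
open import Data.List.Relation.Binary.Pointwise as Pointwise using (Pointwise; []; _∷_)
open import Data.List.Relation.Binary.Prefix.Heterogeneous using (Prefix)
open import Data.List.Relation.Binary.Prefix.Heterogeneous.Properties using (prefix?)
open import Data.List.Relation.Binary.Prefix.Propositional.Properties using (Prefix-as-∣ˡ; ∣ˡ-as-Prefix)
open import Data.List.Relation.Unary.All as All using (All; []; _∷_)
import Data.List.Relation.Unary.All.Properties as Allₚ
open import Data.List.Relation.Unary.AllPairs as AllPairs using (AllPairs; []; _∷_)
open import Data.List.Relation.Unary.Any using (here; there)
open import Data.Maybe using (Maybe; just; nothing)
open import Data.Nat as ℕ using (zero; _+_; _∸_; _<_; z≤n; s≤s; _≟_; _<?_; pred)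
import Data.Nat.Properties as ℕₚ
open import Data.Nat.Solver using (module +-*-Solver)
open import Data.Product using (proj₁; map₂)
open import Data.Sum using (_⊎_; inj₁; inj₂)
open import Function using (_∘_)
open import Level using (_⊔_)
open import Relation.Binary using (IsEquivalence; Setoid)
open import Relation.Binary.PropositionalEquality
  using (_≡_; _≢_; refl; sym; trans; cong; cong₂; subst; module ≡-Reasoning)
import Relation.Binary.PropositionalEquality as ≡
import Relation.Binary.Reasoning.Setoid as SetoidReasoning
open import Relation.Nullary using (¬_; Dec; yes; no)
open import Relation.Nullary.Decidable using (does; dec-true; dec-false; _×-dec_)

open Permutationₛ (≡.setoid ℕ) using (Unique-resp-↭)

lastOr : {A : Set} → A → List A → A
lastOr a []       = a
lastOr a (x ∷ xs) = lastOr x xs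

lastOr-++ : {A : Set} (a : A) (xs ys : List A) → lastOr a (xs ++ ys) ≡ lastOr (lastOr a xs) ys
lastOr-++ a []       ys = refl
lastOr-++ a (x ∷ xs) ys = lastOr-++ x xs ys

lastOr-map : {A B : Set} (f : A → B) (a : A) (xs : List A) → lastOr (f a) (map f xs) ≡ f (lastOr a xs)
lastOr-map f a []       = refl
lastOr-map f a (x ∷ xs) = lastOr-map f x xs

range : ℕ → ℕ → List ℕ
range a zero    = []
range a (suc m) = a ∷ range (suc a) m

range-All : ∀ {p} {P : ℕ → Set p} a m → (∀ {j} → a ≤ j → j < a + m → P j) → All P (range a m)
range-All a zero    f = []
range-All a (suc m) f =
  f ℕₚ.≤-refl (ℕₚ.m<m+n a (s≤s z≤n)) ∷
  range-All (suc a) m (λ {j} a<j j<1+a+m → f (ℕₚ.<⇒≤ a<j) (subst (j <_) (sym (ℕₚ.+-suc a m)) j<1+a+m))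

range-++ : ∀ a m k → range a (m + k) ≡ range a m ++ range (a + m) k
range-++ a zero    k = cong (λ b → range b k) (sym (ℕₚ.+-identityʳ a))
range-++ a (suc m) k =
  cong (a ∷_) (trans (range-++ (suc a) m k) (cong (λ b → range (suc a) m ++ range b k) (sym (ℕₚ.+-suc a m))))

range-shift : ∀ a b m → range (a + b) m ≡ map (a +_) (range b m)
range-shift a b zero    = refl
range-shift a b (suc m) = cong (a + b ∷_) (trans (cong (λ c → range c m) (sym (ℕₚ.+-suc a b))) (range-shift a (suc b) m))

range-unique : ∀ a m → AllPairs _≢_ (range a m)
range-unique a zero    = []
range-unique a (suc m) = range-All (suc a) m (λ a<j _ → ℕₚ.<⇒≢ a<j) ∷ range-unique (suc a) m

length-range : ∀ a m → length (range a m) ≡ m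
length-range a zero    = refl
length-range a (suc m) = cong suc (length-range (suc a) m)

lastOr-range : ∀ a m → lastOr a (range (suc a) m) ≡ a + m
lastOr-range a zero    = sym (ℕₚ.+-identityʳ a)
lastOr-range a (suc m) = trans (lastOr-range (suc a) m) (sym (ℕₚ.+-suc a m))

lookupOr : ∀ {a} {A : Set a} → A → List A → ℕ → A
lookupOr d []       _       = d
lookupOr d (x ∷ _)  zero    = x
lookupOr d (_ ∷ xs) (suc i) = lookupOr d xs i

map-lookupOr-range : ∀ {a} {A : Set a} (d : A) (xs : List A) → map (lookupOr d xs) (range 0 (length xs)) ≡ xs
map-lookupOr-range d []       = refl
map-lookupOr-range d (x ∷ xs) = cong (x ∷_) (begin
  map (lookupOr d (x ∷ xs)) (range 1 (length xs))
    ≡⟨ cong (map (lookupOr d (x ∷ xs))) (range-shift 1 0 (length xs)) ⟩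
  map (lookupOr d (x ∷ xs)) (map suc (range 0 (length xs)))
    ≡⟨ Listₚ.map-∘ (range 0 (length xs)) ⟨
  map (lookupOr d xs) (range 0 (length xs))
    ≡⟨ map-lookupOr-range d xs ⟩
  xs ∎)
  where open ≡-Reasoning

map-lookup-allFin : ∀ {a} {A : Set a} (xs : List A) → map (List.lookup xs) (List.allFin (length xs)) ≡ xs
map-lookup-allFin xs = trans (Listₚ.map-tabulate (λ i → i) (List.lookup xs)) (Listₚ.tabulate-lookup xs)

picks : {A : Set} → List A → List (A × List A)
picks []       = []
picks (x ∷ xs) = (x , xs) ∷ map (map₂ (x ∷_)) (picks xs)

picks-↭ : {A : Set} (xs : List A) → All (λ (y , r) → y ∷ r ↭ xs) (picks xs)
picks-↭ []       = []
picks-↭ (x ∷ xs) =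
  ↭-refl ∷ Allₚ.map⁺ (All.map (λ {(y , r)} p → ↭-trans (↭-swap y x ↭-refl) (↭-prep x p)) (picks-↭ xs))

map-proj₁-picks : {A : Set} (xs : List A) → map proj₁ (picks xs) ≡ xs
map-proj₁-picks []       = refl
map-proj₁-picks (x ∷ xs) = cong (x ∷_) (trans (sym (Listₚ.map-∘ (picks xs))) (map-proj₁-picks xs))

concatMap-concatMap : {A B C : Set} (f : B → List C) (g : A → List B) (xs : List A) →
  concatMap f (concatMap g xs) ≡ concatMap (concatMap f ∘ g) xs
concatMap-concatMap f g []       = refl
concatMap-concatMap f g (x ∷ xs) =
  trans (Listₚ.concatMap-++ f (g x) (concatMap g xs)) (cong (concatMap f (g x) ++_) (concatMap-concatMap f g xs))

concatMap⁺ : {A B : Set} (f : A → List B) {xs ys : List A} → xs ↭ ys → concatMap f xs ↭ concatMap f ys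
concatMap⁺ f ↭.refl         = ↭-refl
concatMap⁺ f (↭.prep x p)   = ++⁺ˡ (f x) (concatMap⁺ f p)
concatMap⁺ f (↭.swap x y p) = ↭-trans (shifts (f x) (f y)) (++⁺ˡ (f y) (++⁺ˡ (f x) (concatMap⁺ f p)))
concatMap⁺ f (↭.trans p q)  = ↭-trans (concatMap⁺ f p) (concatMap⁺ f q)

concatMap-cong-↭ : {A B : Set} {f g : A → List B} → (∀ x → f x ↭ g x) → ∀ xs → concatMap f xs ↭ concatMap g xs
concatMap-cong-↭ f↭g []       = ↭-refl
concatMap-cong-↭ f↭g (x ∷ xs) = ++⁺ (f↭g x) (concatMap-cong-↭ f↭g xs)

concatMap-∷ : {A B : Set} (a : A → B) (f : A → List B) (xs : List A) →
  concatMap (λ x → a x ∷ f x) xs ↭ map a xs ++ concatMap f xs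
concatMap-∷ a f []       = ↭-refl
concatMap-∷ a f (x ∷ xs) = ↭-prep (a x) (↭-trans (++⁺ˡ (f x) (concatMap-∷ a f xs)) (shifts (f x) (map a xs)))

length-map++map∷ʳ : ∀ {a} {A B C : Set a} (f : A → C) (g : B → C) (y : C) (xs : List A) (ys : List B) →
  length (map f xs ++ map g ys ++ y ∷ []) ≡ suc (length xs + length ys)
length-map++map∷ʳ f g y xs ys = begin
  length (map f xs ++ map g ys ++ y ∷ [])
    ≡⟨ Listₚ.length-++ (map f xs) ⟩
  length (map f xs) + length (map g ys ++ y ∷ [])
    ≡⟨ cong₂ _+_ (Listₚ.length-map f xs) (Listₚ.length-++-sucʳ (map g ys) y []) ⟩
  length xs + suc (length (map g ys ++ []))
    ≡⟨ cong (λ k → length xs + suc k) (trans (cong length (Listₚ.++-identityʳ (map g ys))) (Listₚ.length-map g ys)) ⟩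
  length xs + suc (length ys)
    ≡⟨ ℕₚ.+-suc (length xs) (length ys) ⟩
  suc (length xs + length ys) ∎
  where open ≡-Reasoning

2+[a+b]≡2[1+s+t] : ∀ {a b} s t → a ≡ 2 * s → b ≡ 2 * t → 2 + (a + b) ≡ 2 * suc (s + t)
2+[a+b]≡2[1+s+t] s t refl refl =
  solve 2 (λ s t → con 2 :+ (con 2 :* s :+ con 2 :* t) := con 2 :* (con 1 :+ (s :+ t))) refl s t
  where open +-*-Solver

m>0⇒m+n≢0 : ∀ {m n} → 0 < m → m + n ≢ 0
m>0⇒m+n≢0 {m} 0<m = ℕₚ.<⇒≢ 0<m ∘ sym ∘ ℕₚ.m+n≡0⇒m≡0 m

n≢0⇒m+n≢m : ∀ {m n} → n ≢ 0 → m + n ≢ m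
n≢0⇒m+n≢m {m} n≢0 m+n≡m = n≢0 (ℕₚ.+-cancelˡ-≡ m _ 0 (trans m+n≡m (sym (ℕₚ.+-identityʳ m))))

module _ {c ℓ} (F : Field c ℓ) (n : ℕ) where
  open NC F n
  open Field F
    using (Carrier; _≈_; 0#; 1#; +-cong; +-comm; +-assoc; +-identityˡ; *-cong; *-assoc; *-identityˡ; *-identityʳ; distribˡ; zeroʳ)
    renaming (_+_ to _+ᶠ_; _*_ to _*ᶠ_; refl to ≈-refl; sym to ≈-sym; trans to ≈-trans)

  -- Orderings of a list

  insertions-↭ : {A : Set} (x : A) (ys : List A) → All (_↭ x ∷ ys) (insertions x ys)
  insertions-↭ x []       = ↭-refl ∷ []
  insertions-↭ x (y ∷ ys) =
    ↭-refl ∷ Allₚ.map⁺ (All.map (λ p → ↭-trans (↭-prep y p) (↭-swap y x ↭-refl)) (insertions-↭ x ys))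

  All-orderings-↭ : {A : Set} (xs : List A) → All (_↭ xs) (orderings xs)
  All-orderings-↭ []       = ↭-refl ∷ []
  All-orderings-↭ (x ∷ xs) = Allₚ.concat⁺ (Allₚ.map⁺ (All.map
    (λ {σ} σ↭xs → All.map (λ τ↭xσ → ↭-trans τ↭xσ (↭-prep x σ↭xs)) (insertions-↭ x σ))
    (All-orderings-↭ xs)))

  -- Both sides list every way of inserting x and y into σ.
  insertions-comm : {A : Set} (x y : A) (σ : List A) →
    concatMap (insertions x) (insertions y σ) ↭ concatMap (insertions y) (insertions x σ)
  insertions-comm x y []          = ↭-swap _ _ ↭-refl
  insertions-comm {A} x y (z ∷ σ) = begin
    (x ∷ y ∷ z ∷ σ) ∷ (y ∷ x ∷ z ∷ σ) ∷ _  ↭⟨ ↭-prep _ (↭-prep _ (expand x y)) ⟩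
    (x ∷ y ∷ z ∷ σ) ∷ (y ∷ x ∷ z ∷ σ) ∷ P x y ++ P y x ++ map (z ∷_) (concatMap (insertions x) (insertions y σ))
      ↭⟨ ↭-swap _ _ (shifts (P x y) (P y x)) ⟩
    (y ∷ x ∷ z ∷ σ) ∷ (x ∷ y ∷ z ∷ σ) ∷ P y x ++ P x y ++ map (z ∷_) (concatMap (insertions x) (insertions y σ))
      ↭⟨ ↭-prep _ (↭-prep _ (++⁺ˡ (P y x) (++⁺ˡ (P x y) (map⁺ (z ∷_) (insertions-comm x y σ))))) ⟩
    (y ∷ x ∷ z ∷ σ) ∷ (x ∷ y ∷ z ∷ σ) ∷ P y x ++ P x y ++ map (z ∷_) (concatMap (insertions y) (insertions x σ))
      ↭⟨ ↭-prep _ (↭-prep _ (↭-sym (expand y x))) ⟩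
    (y ∷ x ∷ z ∷ σ) ∷ (x ∷ y ∷ z ∷ σ) ∷ _  ∎
    where
    open ↭-Reasoning
    P : A → A → List (List A)
    P a b = map (λ τ → b ∷ z ∷ τ) (insertions a σ)
    expand : ∀ a b → map (b ∷_) (map (z ∷_) (insertions a σ)) ++ concatMap (insertions a) (map (z ∷_) (insertions b σ))
                     ↭ P a b ++ P b a ++ map (z ∷_) (concatMap (insertions a) (insertions b σ))
    expand a b = ++⁺ (↭-reflexive (sym (Listₚ.map-∘ (insertions a σ)))) (begin
      concatMap (insertions a) (map (z ∷_) (insertions b σ))
        ≡⟨ Listₚ.concatMap-map (insertions a) (z ∷_) (insertions b σ) ⟩
      concatMap (λ τ → (a ∷ z ∷ τ) ∷ map (z ∷_) (insertions a τ)) (insertions b σ)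
        ↭⟨ concatMap-∷ (λ τ → a ∷ z ∷ τ) (map (z ∷_) ∘ insertions a) (insertions b σ) ⟩
      P b a ++ concatMap (map (z ∷_) ∘ insertions a) (insertions b σ)
        ≡⟨ cong (P b a ++_) (sym (Listₚ.map-concatMap (z ∷_) (insertions a) (insertions b σ))) ⟩
      P b a ++ map (z ∷_) (concatMap (insertions a) (insertions b σ)) ∎)

  orderings⁺ : {A : Set} {xs ys : List A} → xs ↭ ys → orderings xs ↭ orderings ys
  orderings⁺ ↭.refl                    = ↭-refl
  orderings⁺ (↭.prep x p)              = concatMap⁺ (insertions x) (orderings⁺ p)
  orderings⁺ (↭.swap {xs} {ys} x y p) = begin
    concatMap (insertions x) (concatMap (insertions y) (orderings xs))
      ≡⟨ concatMap-concatMap (insertions x) (insertions y) (orderings xs) ⟩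
    concatMap (concatMap (insertions x) ∘ insertions y) (orderings xs)
      ↭⟨ concatMap-cong-↭ (insertions-comm x y) (orderings xs) ⟩
    concatMap (concatMap (insertions y) ∘ insertions x) (orderings xs)
      ↭⟨ concatMap⁺ _ (orderings⁺ p) ⟩
    concatMap (concatMap (insertions y) ∘ insertions x) (orderings ys)
      ≡⟨ concatMap-concatMap (insertions y) (insertions x) (orderings ys) ⟨
    concatMap (insertions y) (concatMap (insertions x) (orderings ys)) ∎
    where open ↭-Reasoning
  orderings⁺ (↭.trans p q)             = ↭-trans (orderings⁺ p) (orderings⁺ q)

  insertions-map : {A B : Set} (f : A → B) (x : A) (ys : List A) →
    insertions (f x) (map f ys) ≡ map (map f) (insertions x ys)
  insertions-map f x []       = refl
  insertions-map f x (y ∷ ys) = cong ((f x ∷ f y ∷ map f ys) ∷_) (begin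
    map (f y ∷_) (insertions (f x) (map f ys))  ≡⟨ cong (map (f y ∷_)) (insertions-map f x ys) ⟩
    map (f y ∷_) (map (map f) (insertions x ys)) ≡⟨ Listₚ.map-∘ (insertions x ys) ⟨
    map (map f ∘ (y ∷_)) (insertions x ys)       ≡⟨ Listₚ.map-∘ (insertions x ys) ⟩
    map (map f) (map (y ∷_) (insertions x ys))   ∎)
    where open ≡-Reasoning

  orderings-map : {A B : Set} (f : A → B) (xs : List A) → orderings (map f xs) ≡ map (map f) (orderings xs)
  orderings-map f []       = refl
  orderings-map f (x ∷ xs) = begin
    concatMap (insertions (f x)) (orderings (map f xs))
      ≡⟨ cong (concatMap (insertions (f x))) (orderings-map f xs) ⟩
    concatMap (insertions (f x)) (map (map f) (orderings xs))
      ≡⟨ Listₚ.concatMap-map (insertions (f x)) (map f) (orderings xs) ⟩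
    concatMap (insertions (f x) ∘ map f) (orderings xs)
      ≡⟨ Listₚ.concatMap-cong (insertions-map f x) (orderings xs) ⟩
    concatMap (map (map f) ∘ insertions x) (orderings xs)
      ≡⟨ Listₚ.map-concatMap (map f) (insertions x) (orderings xs) ⟨
    map (map f) (concatMap (insertions x) (orderings xs)) ∎
    where open ≡-Reasoning

  -- Polynomials up to equality of coefficients

  -- A record rather than a synonym of _≈ₚ_, so that Agda can infer both polynomials from the type.
  infix 4 _≋_
  record _≋_ (p q : NCPoly) : Set ℓ where
    constructor mk≋
    field ≋⇒≈ₚ : p ≈ₚ q
  open _≋_

  ≋-refl : ∀ {p} → p ≋ p
  ≋-refl = mk≋ λ _ → ≈-refl

  ≋-sym : ∀ {p q} → p ≋ q → q ≋ p
  ≋-sym p≋q = mk≋ λ w → ≈-sym (≋⇒≈ₚ p≋q w)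

  ≋-trans : ∀ {p q r} → p ≋ q → q ≋ r → p ≋ r
  ≋-trans p≋q q≋r = mk≋ λ w → ≈-trans (≋⇒≈ₚ p≋q w) (≋⇒≈ₚ q≋r w)

  ≡⇒≋ : ∀ {p q} → p ≡ q → p ≋ q
  ≡⇒≋ refl = ≋-refl

  ≋-isEquivalence : IsEquivalence _≋_
  ≋-isEquivalence = record { refl = ≋-refl ; sym = ≋-sym ; trans = ≋-trans }

  ≋-setoid : Setoid c ℓ
  ≋-setoid = record { isEquivalence = ≋-isEquivalence }

  module ≋-Reasoning = SetoidReasoning ≋-setoid

  coeff-+ₚ : ∀ p q w → coeff (p +ₚ q) w ≈ coeff p w +ᶠ coeff q w
  coeff-+ₚ []            q w = ≈-sym (+-identityˡ _)
  coeff-+ₚ ((a , u) ∷ p) q w with Listₚ.≡-dec Fin._≟_ u w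
  ... | yes _ = ≈-trans (+-cong ≈-refl (coeff-+ₚ p q w)) (≈-sym (+-assoc _ _ _))
  ... | no  _ = coeff-+ₚ p q w

  +ₚ-cong : ∀ {p p′ q q′} → p ≋ p′ → q ≋ q′ → p +ₚ q ≋ p′ +ₚ q′
  +ₚ-cong {p} {p′} {q} {q′} p≋p′ q≋q′ = mk≋ λ w → begin
    coeff (p +ₚ q) w           ≈⟨ coeff-+ₚ p q w ⟩
    coeff p w +ᶠ coeff q w     ≈⟨ +-cong (≋⇒≈ₚ p≋p′ w) (≋⇒≈ₚ q≋q′ w) ⟩
    coeff p′ w +ᶠ coeff q′ w   ≈⟨ coeff-+ₚ p′ q′ w ⟨
    coeff (p′ +ₚ q′) w         ∎
    where open SetoidReasoning (Field.setoid F)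

  +ₚ-comm : ∀ p q → p +ₚ q ≋ q +ₚ p
  +ₚ-comm p q = mk≋ λ w → ≈-trans (coeff-+ₚ p q w) (≈-trans (+-comm _ _) (≈-sym (coeff-+ₚ q p w)))

  +ₚ-isCommutativeMonoid : IsCommutativeMonoid _≋_ _+ₚ_ 0ₚ
  +ₚ-isCommutativeMonoid = record
    { isMonoid = record
      { isSemigroup = record
        { isMagma = record { isEquivalence = ≋-isEquivalence ; ∙-cong = +ₚ-cong }
        ; assoc   = λ p q r → ≡⇒≋ (Listₚ.++-assoc p q r)
        }
      ; identity = (λ _ → ≋-refl) , (λ p → ≡⇒≋ (Listₚ.++-identityʳ p))
      }
    ; comm = +ₚ-comm
    }

  +ₚ-commutativeMonoid : CommutativeMonoid c ℓ
  +ₚ-commutativeMonoid = record { isCommutativeMonoid = +ₚ-isCommutativeMonoid }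

  open CommutativeSemigroupProperties (CommutativeMonoid.commutativeSemigroup +ₚ-commutativeMonoid)
    using (interchange)

  +ₚ-identityʳ : ∀ p → p +ₚ 0ₚ ≋ p
  +ₚ-identityʳ p = ≡⇒≋ (Listₚ.++-identityʳ p)

  sumₚ-++ : ∀ ps qs → sumₚ (ps ++ qs) ≡ sumₚ ps +ₚ sumₚ qs
  sumₚ-++ ps qs = sym (Listₚ.concat-++ ps qs)

  sumₚ-↭ : ∀ {ps qs} → ps ↭ qs → sumₚ ps ≋ sumₚ qs
  sumₚ-↭ ps↭qs = Permutationₛ.foldr-commMonoid ≋-setoid +ₚ-isCommutativeMonoid (↭⇒↭ₛ′ ≋-isEquivalence ps↭qs)

  module _ {A : Set} where

    sum-map-cong : ∀ {f g : A → NCPoly} xs → All (λ x → f x ≋ g x) xs → sumₚ (map f xs) ≋ sumₚ (map g xs)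
    sum-map-cong []       []           = ≋-refl
    sum-map-cong (_ ∷ xs) (fx≋gx ∷ eq) = +ₚ-cong fx≋gx (sum-map-cong xs eq)

    sum-map-zero : ∀ {f : A → NCPoly} xs → All (λ x → f x ≋ 0ₚ) xs → sumₚ (map f xs) ≋ 0ₚ
    sum-map-zero []       []          = ≋-refl
    sum-map-zero (_ ∷ xs) (fx≋0 ∷ eq) = +ₚ-cong fx≋0 (sum-map-zero xs eq)

    sum-map-+ₚ : ∀ (f g : A → NCPoly) xs → sumₚ (map (λ x → f x +ₚ g x) xs) ≋ sumₚ (map f xs) +ₚ sumₚ (map g xs)
    sum-map-+ₚ f g []       = ≋-refl
    sum-map-+ₚ f g (x ∷ xs) = ≋-trans (+ₚ-cong ≋-refl (sum-map-+ₚ f g xs)) (interchange (f x) (g x) _ _)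

    sum-map-concatMap : ∀ {B : Set} (f : B → NCPoly) (g : A → List B) xs →
      sumₚ (map f (concatMap g xs)) ≡ sumₚ (map (λ x → sumₚ (map f (g x))) xs)
    sum-map-concatMap f g []       = refl
    sum-map-concatMap f g (x ∷ xs) = begin
      sumₚ (map f (g x ++ concatMap g xs))               ≡⟨ cong sumₚ (Listₚ.map-++ f (g x) _) ⟩
      sumₚ (map f (g x) ++ map f (concatMap g xs))       ≡⟨ sumₚ-++ (map f (g x)) _ ⟩
      sumₚ (map f (g x)) +ₚ sumₚ (map f (concatMap g xs)) ≡⟨ cong (sumₚ (map f (g x)) +ₚ_) (sum-map-concatMap f g xs) ⟩
      sumₚ (map f (g x)) +ₚ sumₚ (map (λ x → sumₚ (map f (g x))) xs) ∎
      where open ≡-Reasoning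

  scale : Carrier → Word → NCPoly → NCPoly
  scale a u = map (λ (b , v) → (a *ᶠ b , u ++ v))

  coeff-scale-++ : ∀ a u q v → coeff (scale a u q) (u ++ v) ≈ a *ᶠ coeff q v
  coeff-scale-++ a u []             v = ≈-sym (zeroʳ a)
  coeff-scale-++ a u ((b , v′) ∷ q) v
    with Listₚ.≡-dec Fin._≟_ (u ++ v′) (u ++ v) | Listₚ.≡-dec Fin._≟_ v′ v
  ... | yes _   | yes _   = ≈-trans (+-cong ≈-refl (coeff-scale-++ a u q v)) (≈-sym (distribˡ a b _))
  ... | yes eq  | no v′≢v = ⊥-elim (v′≢v (Listₚ.++-cancelˡ u v′ v eq))
  ... | no neq  | yes eq  = ⊥-elim (neq (cong (u ++_) eq))
  ... | no _    | no _    = coeff-scale-++ a u q v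

  coeff-scale-∤ : ∀ a u q w → ¬ (∃ λ v → u ++ v ≡ w) → coeff (scale a u q) w ≈ 0#
  coeff-scale-∤ a u []             w u∤w = ≈-refl
  coeff-scale-∤ a u ((b , v) ∷ q) w u∤w with Listₚ.≡-dec Fin._≟_ (u ++ v) w
  ... | yes eq = ⊥-elim (u∤w (v , eq))
  ... | no _   = coeff-scale-∤ a u q w u∤w

  scale-cong : ∀ a u {q q′} → q ≋ q′ → scale a u q ≋ scale a u q′
  scale-cong a u {q} {q′} q≋q′ = mk≋ λ w → coeff-scale-cong w (prefix? Fin._≟_ u w)
    where
    coeff-scale-cong : ∀ w → Dec (Prefix _≡_ u w) → coeff (scale a u q) w ≈ coeff (scale a u q′) w
    coeff-scale-cong w (yes u≤w) with Prefix-as-∣ˡ u≤w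
    ... | record { quotient = v ; equality = refl } = ≈-trans (coeff-scale-++ a u q v)
                      (≈-trans (*-cong ≈-refl (≋⇒≈ₚ q≋q′ v)) (≈-sym (coeff-scale-++ a u q′ v)))
    coeff-scale-cong w (no u≰w) = ≈-trans (coeff-scale-∤ a u q w u∤w) (≈-sym (coeff-scale-∤ a u q′ w u∤w))
      where
      u∤w : ¬ (∃ λ v → u ++ v ≡ w)
      u∤w (v , eq) = u≰w (∣ˡ-as-Prefix record { quotient = v ; equality = eq })

  *ₚ-congˡ : ∀ p {q q′} → q ≋ q′ → p *ₚ q ≋ p *ₚ q′
  *ₚ-congˡ []            q≋q′ = ≋-refl
  *ₚ-congˡ ((a , u) ∷ p) q≋q′ = +ₚ-cong (scale-cong a u q≋q′) (*ₚ-congˡ p q≋q′)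

  *ₚ-zeroʳ : ∀ p → p *ₚ 0ₚ ≡ 0ₚ
  *ₚ-zeroʳ []      = refl
  *ₚ-zeroʳ (_ ∷ p) = *ₚ-zeroʳ p

  *ₚ-distribʳ : ∀ p q r → (p +ₚ q) *ₚ r ≡ (p *ₚ r) +ₚ (q *ₚ r)
  *ₚ-distribʳ p q r = Listₚ.concatMap-++ _ p q

  *ₚ-distribˡ : ∀ p q r → p *ₚ (q +ₚ r) ≋ (p *ₚ q) +ₚ (p *ₚ r)
  *ₚ-distribˡ []            q r = ≋-refl
  *ₚ-distribˡ ((a , u) ∷ p) q r =
    ≋-trans (+ₚ-cong (≡⇒≋ (Listₚ.map-++ _ q r)) (*ₚ-distribˡ p q r)) (interchange (scale a u q) (scale a u r) _ _)

  *ₚ-sum : ∀ {A : Set} p (f : A → NCPoly) xs → p *ₚ sumₚ (map f xs) ≋ sumₚ (map (λ x → p *ₚ f x) xs)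
  *ₚ-sum p f []       = ≡⇒≋ (*ₚ-zeroʳ p)
  *ₚ-sum p f (x ∷ xs) = ≋-trans (*ₚ-distribˡ p (f x) _) (+ₚ-cong ≋-refl (*ₚ-sum p f xs))

  infix 4 _≐_
  _≐_ : NCPoly → NCPoly → Set (c ⊔ ℓ)
  _≐_ = Pointwise (λ (a , u) (b , v) → a ≈ b × u ≡ v)

  ≐⇒≋ : ∀ {p q} → p ≐ q → p ≋ q
  ≐⇒≋ p≐q = mk≋ (coeff-≐ p≐q)
    where
    coeff-≐ : ∀ {p q} → p ≐ q → p ≈ₚ q
    coeff-≐ []                                  w = ≈-refl
    coeff-≐ (_∷_ {(_ , u)} (a≈b , refl) p≐q) w with Listₚ.≡-dec Fin._≟_ u w
    ... | yes _ = +-cong a≈b (coeff-≐ p≐q w)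
    ... | no  _ = coeff-≐ p≐q w

  scale-scale : ∀ a u b v r → scale (a *ᶠ b) (u ++ v) r ≐ scale a u (scale b v r)
  scale-scale a u b v []            = []
  scale-scale a u b v ((d , x) ∷ r) = (*-assoc a b d , Listₚ.++-assoc u v x) ∷ scale-scale a u b v r

  scale-*ₚ : ∀ a u q r → scale a u q *ₚ r ≐ scale a u (q *ₚ r)
  scale-*ₚ a u []            r = []
  scale-*ₚ a u ((b , v) ∷ q) r =
    subst (scale a u ((b , v) ∷ q) *ₚ r ≐_) (sym (Listₚ.map-++ _ (scale b v r) (q *ₚ r)))
      (Pointwise.++⁺ (scale-scale a u b v r) (scale-*ₚ a u q r))

  *ₚ-assoc : ∀ p q r → (p *ₚ q) *ₚ r ≋ p *ₚ (q *ₚ r)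
  *ₚ-assoc []            q r = ≋-refl
  *ₚ-assoc ((a , u) ∷ p) q r =
    ≋-trans (≡⇒≋ (*ₚ-distribʳ (scale a u q) (p *ₚ q) r)) (+ₚ-cong (≐⇒≋ (scale-*ₚ a u q r)) (*ₚ-assoc p q r))

  1ₚ : NCPoly
  1ₚ = constₚ 1#

  *ₚ-identityˡ : ∀ p → 1ₚ *ₚ p ≋ p
  *ₚ-identityˡ p = ≋-trans (+ₚ-identityʳ _) (≐⇒≋ (scale-1 p))
    where
    scale-1 : ∀ p → scale 1# [] p ≐ p
    scale-1 []            = []
    scale-1 ((b , v) ∷ p) = (*-identityˡ b , refl) ∷ scale-1 p

  *ₚ-identityʳ : ∀ p → p *ₚ 1ₚ ≋ p
  *ₚ-identityʳ p = ≐⇒≋ (*-1 p)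
    where
    *-1 : ∀ p → p *ₚ 1ₚ ≐ p
    *-1 []            = []
    *-1 ((a , u) ∷ p) = (*-identityʳ a , Listₚ.++-identityʳ u) ∷ *-1 p

  -- Sums over Hamiltonian paths

  onHead : {A : Set} → (A → List A → NCPoly) → List A → NCPoly
  onHead f []      = 0ₚ
  onHead f (y ∷ ρ) = f y ρ

  sum-orderings-onHead : {A : Set} (f : A → List A → NCPoly) (xs : List A) →
    sumₚ (map (onHead f) (orderings xs)) ≋ sumₚ (map (λ (y , r) → sumₚ (map (f y) (orderings r))) (picks xs))
  sum-orderings-onHead     f []       = ≋-refl
  sum-orderings-onHead {A} f (x ∷ xs) = begin
    sumₚ (map (onHead f) (concatMap (insertions x) (orderings xs)))
      ≡⟨ sum-map-concatMap (onHead f) (insertions x) (orderings xs) ⟩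
    sumₚ (map (λ σ → sumₚ (map (onHead f) (insertions x σ))) (orderings xs))
      ≈⟨ sum-map-cong (orderings xs) (All.tabulate λ {σ} _ → sum-insertions σ) ⟩
    sumₚ (map (λ σ → f x σ +ₚ onHead g σ) (orderings xs))
      ≈⟨ sum-map-+ₚ (f x) (onHead g) (orderings xs) ⟩
    sumₚ (map (f x) (orderings xs)) +ₚ sumₚ (map (onHead g) (orderings xs))
      ≈⟨ +ₚ-cong ≋-refl (sum-orderings-onHead g xs) ⟩
    sumₚ (map (f x) (orderings xs)) +ₚ sumₚ (map (λ (y , r) → sumₚ (map (g y) (orderings r))) (picks xs))
      ≡⟨ cong (λ h → sumₚ (map (f x) (orderings xs)) +ₚ sumₚ h) (Listₚ.map-cong
           (λ (y , r) → sym (sum-map-concatMap (f y) (insertions x) (orderings r))) (picks xs)) ⟩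
    sumₚ (map (f x) (orderings xs)) +ₚ sumₚ (map (λ (y , r) → sumₚ (map (f y) (orderings (x ∷ r)))) (picks xs))
      ≡⟨ cong (λ h → sumₚ (map (f x) (orderings xs)) +ₚ sumₚ h) (Listₚ.map-∘ (picks xs)) ⟩
    sumₚ (map (λ (y , r) → sumₚ (map (f y) (orderings r))) (picks (x ∷ xs))) ∎
    where
    open ≋-Reasoning
    g : A → List A → NCPoly
    g y ρ = sumₚ (map (f y) (insertions x ρ))
    sum-insertions : ∀ σ → sumₚ (map (onHead f) (insertions x σ)) ≋ f x σ +ₚ onHead g σ
    sum-insertions []      = ≋-refl
    sum-insertions (y ∷ ρ) = ≡⇒≋ (cong (λ h → f x (y ∷ ρ) +ₚ sumₚ h) (sym (Listₚ.map-∘ (insertions x ρ))))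

  module Paths {V : Set} (wt : V → V → NCPoly) (t : V) where

    walkTo : V → List V → NCPoly
    walkTo u []       = wt u t
    walkTo u (v ∷ vs) = wt u v *ₚ walkTo v vs

    pathSum : V → List V → NCPoly
    pathSum u S = sumₚ (map (walkTo u) (orderings S))

    pathSum-[] : ∀ u → pathSum u [] ≋ wt u t
    pathSum-[] u = +ₚ-identityʳ (wt u t)

    pathSum-↭ : ∀ u {S S′} → S ↭ S′ → pathSum u S ≋ pathSum u S′
    pathSum-↭ u S↭S′ = sumₚ-↭ (map⁺ (walkTo u) (orderings⁺ S↭S′))

    pathSum-∷ : ∀ u s S → pathSum u (s ∷ S) ≋ sumₚ (map (λ (y , r) → wt u y *ₚ pathSum y r) (picks (s ∷ S)))
    pathSum-∷ u s S = begin
      sumₚ (map (walkTo u) (orderings (s ∷ S)))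
        ≡⟨ cong sumₚ (Listₚ.map-cong-local (All.map walkTo-onHead (All-orderings-↭ (s ∷ S)))) ⟩
      sumₚ (map (onHead (λ y ρ → wt u y *ₚ walkTo y ρ)) (orderings (s ∷ S)))
        ≈⟨ sum-orderings-onHead _ (s ∷ S) ⟩
      sumₚ (map (λ (y , r) → sumₚ (map (λ ρ → wt u y *ₚ walkTo y ρ) (orderings r))) (picks (s ∷ S)))
        ≈⟨ sum-map-cong (picks (s ∷ S)) (All.tabulate λ {(y , r)} _ → ≋-sym (*ₚ-sum (wt u y) (walkTo y) (orderings r))) ⟩
      sumₚ (map (λ (y , r) → wt u y *ₚ pathSum y r) (picks (s ∷ S))) ∎
      where
      open ≋-Reasoning
      walkTo-onHead : ∀ {π} → π ↭ s ∷ S → walkTo u π ≡ onHead (λ y ρ → wt u y *ₚ walkTo y ρ) π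
      walkTo-onHead {[]}    []↭ with () ← ↭-empty-inv (↭-sym []↭)
      walkTo-onHead {_ ∷ _} _   = refl

    walkTo-unreachable : ∀ {x v π} → x ∈ π → All (λ z → wt z x ≡ 0ₚ) (v ∷ π) → walkTo v π ≋ 0ₚ
    walkTo-unreachable {π = x ∷ π} (here refl) (wvx ∷ _) = ≡⇒≋ (cong (_*ₚ walkTo x π) wvx)
    walkTo-unreachable {v = v} {y ∷ π} (there x∈π) (_ ∷ noEdges) =
      ≋-trans (*ₚ-congˡ (wt v y) (walkTo-unreachable x∈π noEdges)) (≡⇒≋ (*ₚ-zeroʳ (wt v y)))

    pathSum-unreachable : ∀ {x v S} → x ∈ S → All (λ z → wt z x ≡ 0ₚ) (v ∷ S) → pathSum v S ≋ 0ₚ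
    pathSum-unreachable {S = S} x∈S (wvx ∷ noEdges) = sum-map-zero (orderings S) (All.map
      (λ π↭S → walkTo-unreachable (∈-resp-↭ (↭-sym π↭S) x∈S) (wvx ∷ All-resp-↭ (↭-sym π↭S) noEdges))
      (All-orderings-↭ S))

    pathSum-forced : ∀ u x S → All (λ z → wt z x ≡ 0ₚ) (x ∷ S) → pathSum u (x ∷ S) ≋ wt u x *ₚ pathSum x S
    pathSum-forced u x S noEdges = begin
      pathSum u (x ∷ S)
        ≈⟨ pathSum-∷ u x S ⟩
      (wt u x *ₚ pathSum x S) +ₚ sumₚ (map (λ (y , r) → wt u y *ₚ pathSum y r) (map (map₂ (x ∷_)) (picks S)))
        ≈⟨ +ₚ-cong ≋-refl (sum-map-zero (map (map₂ (x ∷_)) (picks S))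
             (Allₚ.map⁺ (All.map (λ {(y , r)} → later-vanishes y r) (picks-↭ S)))) ⟩
      (wt u x *ₚ pathSum x S) +ₚ 0ₚ
        ≈⟨ +ₚ-identityʳ _ ⟩
      wt u x *ₚ pathSum x S ∎
      where
      open ≋-Reasoning
      later-vanishes : ∀ y r → y ∷ r ↭ S → wt u y *ₚ pathSum y (x ∷ r) ≋ 0ₚ
      later-vanishes y r y∷r↭S = ≋-trans
        (*ₚ-congˡ (wt u y) (pathSum-unreachable (here refl)
          (All-resp-↭ (↭-trans (↭-prep x (↭-sym y∷r↭S)) (↭-swap x y ↭-refl)) noEdges)))
        (≡⇒≋ (*ₚ-zeroʳ (wt u y)))

    pathSum-by-first : ∀ u s S (rest : V → List V) → All (λ y → wt u y ≡ 0ₚ ⊎ y ∷ rest y ↭ s ∷ S) (s ∷ S) →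
      pathSum u (s ∷ S) ≋ sumₚ (map (λ y → wt u y *ₚ pathSum y (rest y)) (s ∷ S))
    pathSum-by-first u s S rest options = begin
      pathSum u (s ∷ S)
        ≈⟨ pathSum-∷ u s S ⟩
      sumₚ (map (λ (y , r) → wt u y *ₚ pathSum y r) (picks (s ∷ S)))
        ≈⟨ sum-map-cong (picks (s ∷ S)) (All.map (λ {(y , r)} → any-rest y r) (picks-↭ (s ∷ S))) ⟩
      sumₚ (map (λ (y , _) → wt u y *ₚ pathSum y (rest y)) (picks (s ∷ S)))
        ≡⟨ cong sumₚ (Listₚ.map-∘ (picks (s ∷ S))) ⟩
      sumₚ (map (λ y → wt u y *ₚ pathSum y (rest y)) (map proj₁ (picks (s ∷ S))))
        ≡⟨ cong (λ ys → sumₚ (map (λ y → wt u y *ₚ pathSum y (rest y)) ys)) (map-proj₁-picks (s ∷ S)) ⟩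
      sumₚ (map (λ y → wt u y *ₚ pathSum y (rest y)) (s ∷ S)) ∎
      where
      open ≋-Reasoning
      any-rest : ∀ y r → y ∷ r ↭ s ∷ S → wt u y *ₚ pathSum y r ≋ wt u y *ₚ pathSum y (rest y)
      any-rest y r y∷r↭ with All.lookup options (∈-resp-↭ y∷r↭ (here refl))
      ... | inj₁ wuy≡0  rewrite wuy≡0 = ≋-refl
      ... | inj₂ y∷rest↭ = *ₚ-congˡ (wt u y) (pathSum-↭ y (drop-∷ (↭-trans y∷r↭ (↭-sym y∷rest↭))))

    data ForcedPath : V → List V → List V → Set c where
      []  : ∀ {u R} → ForcedPath u [] R
      _∷_ : ∀ {u x xs R} → wt u x ≡ 1ₚ × All (λ z → wt z x ≡ 0ₚ) (x ∷ xs ++ R) →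
            ForcedPath x xs R → ForcedPath u (x ∷ xs) R

    pathSum-forcedPath : ∀ {u xs R} → ForcedPath u xs R → pathSum u (xs ++ R) ≋ pathSum (lastOr u xs) R
    pathSum-forcedPath []                                       = ≋-refl
    pathSum-forcedPath {u} (_∷_ {x = x} {xs} {R} (wux , noEdges) path) = begin
      pathSum u (x ∷ xs ++ R)       ≈⟨ pathSum-forced u x (xs ++ R) noEdges ⟩
      wt u x *ₚ pathSum x (xs ++ R) ≡⟨ cong (_*ₚ pathSum x (xs ++ R)) wux ⟩
      1ₚ *ₚ pathSum x (xs ++ R)     ≈⟨ *ₚ-identityˡ _ ⟩
      pathSum x (xs ++ R)           ≈⟨ pathSum-forcedPath path ⟩
      pathSum (lastOr x xs) R       ∎
      where open ≋-Reasoning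

  HC-relabel : ∀ {m} (G : Graph (suc m)) {V : Set} (wt : V → V → NCPoly) (f : Fin (suc m) → V) →
    (∀ x y → weight G x y ≡ wt (f x) (f y)) →
    HC G ≡ Paths.pathSum wt (f Fin.zero) (f Fin.zero) (map (f ∘ Fin.suc) (List.allFin m))
  HC-relabel {m} G wt f weight≡ = begin
    sumₚ (map (walk G Fin.zero) (orderings S))
      ≡⟨ cong sumₚ (Listₚ.map-cong walk-relabel (orderings S)) ⟩
    sumₚ (map (walkTo (f Fin.zero) ∘ map f) (orderings S))
      ≡⟨ cong sumₚ (Listₚ.map-∘ (orderings S)) ⟩
    sumₚ (map (walkTo (f Fin.zero)) (map (map f) (orderings S)))
      ≡⟨ cong (λ πs → sumₚ (map (walkTo (f Fin.zero)) πs)) (orderings-map f S) ⟨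
    sumₚ (map (walkTo (f Fin.zero)) (orderings (map f S)))
      ≡⟨ cong (λ vs → sumₚ (map (walkTo (f Fin.zero)) (orderings vs))) (Listₚ.map-∘ (List.allFin m)) ⟨
    Paths.pathSum wt (f Fin.zero) (f Fin.zero) (map (f ∘ Fin.suc) (List.allFin m)) ∎
    where
    open ≡-Reasoning
    open Paths wt (f Fin.zero)
    S : List (Fin (suc m))
    S = map Fin.suc (List.allFin m)
    walk-relabel : ∀ {u} vs → walk G u vs ≡ walkTo (f u) (map f vs)
    walk-relabel {u} []       = weight≡ u Fin.zero
    walk-relabel {u} (v ∷ vs) = cong₂ _*ₚ_ (weight≡ u v) (walk-relabel vs)

  -- Algebraic branching programs

  ∑< : ℕ → (ℕ → NCPoly) → NCPoly
  ∑< zero    f = 0ₚ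
  ∑< (suc W) f = f 0 +ₚ ∑< W (f ∘ suc)

  ∑<-cong : ∀ W {f g} → (∀ {j} → j < W → f j ≋ g j) → ∑< W f ≋ ∑< W g
  ∑<-cong zero    f≋g = ≋-refl
  ∑<-cong (suc W) f≋g = +ₚ-cong (f≋g (s≤s z≤n)) (∑<-cong W (f≋g ∘ s≤s))

  ∑<-zero : ∀ W {f} → (∀ {j} → j < W → f j ≋ 0ₚ) → ∑< W f ≋ 0ₚ
  ∑<-zero zero    f≋0 = ≋-refl
  ∑<-zero (suc W) f≋0 = +ₚ-cong (f≋0 (s≤s z≤n)) (∑<-zero W (f≋0 ∘ s≤s))

  ∑<-single : ∀ {W f} i → i < W → (∀ {j} → j < W → j ≢ i → f j ≋ 0ₚ) → ∑< W f ≋ f i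
  ∑<-single {suc W} zero    _         others =
    ≋-trans (+ₚ-cong ≋-refl (∑<-zero W λ j<W → others (s≤s j<W) ℕₚ.1+n≢0)) (+ₚ-identityʳ _)
  ∑<-single {suc W} (suc i) (s≤s i<W) others =
    +ₚ-cong (others (s≤s z≤n) (ℕₚ.1+n≢0 ∘ sym))
            (∑<-single i i<W λ j<W j≢i → others (s≤s j<W) (j≢i ∘ ℕₚ.suc-injective))

  ∑<-+ : ∀ W₁ W₂ f → ∑< (W₁ + W₂) f ≋ ∑< W₁ f +ₚ ∑< W₂ (λ j → f (W₁ + j))
  ∑<-+ zero     W₂ f = ≋-refl
  ∑<-+ (suc W₁) W₂ f =
    ≋-trans (+ₚ-cong ≋-refl (∑<-+ W₁ W₂ (f ∘ suc))) (≡⇒≋ (sym (Listₚ.++-assoc (f 0) _ _)))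

  sum-range : ∀ W f → sumₚ (map f (range 0 W)) ≡ ∑< W f
  sum-range zero    f = refl
  sum-range (suc W) f = cong (f 0 +ₚ_) (begin
    sumₚ (map f (range 1 W))            ≡⟨ cong (sumₚ ∘ map f) (range-shift 1 0 W) ⟩
    sumₚ (map f (map suc (range 0 W)))  ≡⟨ cong sumₚ (Listₚ.map-∘ (range 0 W)) ⟨
    sumₚ (map (f ∘ suc) (range 0 W))    ≡⟨ sum-range W (f ∘ suc) ⟩
    ∑< W (f ∘ suc)                      ∎)
    where open ≡-Reasoning

  Matrix : Set c
  Matrix = ℕ → ℕ → Maybe Label

  entry : Maybe Label → NCPoly
  entry nothing  = 0ₚ
  entry (just l) = labelPoly l

  one : Label
  one = lcst 1#

  mulVec : ℕ → Matrix → (ℕ → NCPoly) → ℕ → NCPoly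
  mulVec W M v i = ∑< W (λ j → entry (M i j) *ₚ v j)

  mulVecs : ℕ → List Matrix → (ℕ → NCPoly) → ℕ → NCPoly
  mulVecs W Ms v = foldr (mulVec W) v Ms

  e₀ : NCPoly → ℕ → NCPoly
  e₀ q zero    = q
  e₀ q (suc _) = 0ₚ

  mulVec-cong : ∀ W M {v v′} → (∀ {j} → j < W → v j ≋ v′ j) → ∀ i → mulVec W M v i ≋ mulVec W M v′ i
  mulVec-cong W M v≋v′ i = ∑<-cong W (λ {j} j<W → *ₚ-congˡ (entry (M i j)) (v≋v′ j<W))

  mulVecs-cong : ∀ W Ms {v v′} → (∀ {j} → j < W → v j ≋ v′ j) →
                 ∀ {i} → i < W → mulVecs W Ms v i ≋ mulVecs W Ms v′ i
  mulVecs-cong W []       v≋v′ i<W = v≋v′ i<W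
  mulVecs-cong W (M ∷ Ms) v≋v′ {i} _ = mulVec-cong W M (mulVecs-cong W Ms v≋v′) i

  mulVecs-++ : ∀ W As Bs v → mulVecs W (As ++ Bs) v ≡ mulVecs W As (mulVecs W Bs v)
  mulVecs-++ W As Bs v = Listₚ.foldr-++ (mulVec W) v As Bs

  mulVec-e₀ : ∀ W M q i → 0 < W → mulVec W M (e₀ q) i ≋ entry (M i 0) *ₚ q
  mulVec-e₀ W M q i 0<W = ∑<-single 0 0<W λ {j} _ j≢0 → ≡⇒≋ (vanish j j≢0)
    where
    vanish : ∀ j → j ≢ 0 → entry (M i j) *ₚ e₀ q j ≡ 0ₚ
    vanish zero    j≢0 = ⊥-elim (j≢0 refl)
    vanish (suc j) _   = *ₚ-zeroʳ (entry (M i (suc j)))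

  idMatrix : Matrix
  idMatrix i j = if does (i ≟ j) then just one else nothing

  mulVec-idMatrix : ∀ W v {i} → i < W → mulVec W idMatrix v i ≋ v i
  mulVec-idMatrix W v {i} i<W = ≋-trans (∑<-single i i<W off-diagonal) diagonal
    where
    diagonal : entry (idMatrix i i) *ₚ v i ≋ v i
    diagonal rewrite dec-true (i ≟ i) refl = *ₚ-identityˡ (v i)
    off-diagonal : ∀ {j} → j < W → j ≢ i → entry (idMatrix i j) *ₚ v j ≋ 0ₚ
    off-diagonal {j} _ j≢i rewrite dec-false (i ≟ j) (j≢i ∘ sym) = ≋-refl

  blockDiag : ℕ → Matrix → Matrix → Matrix
  blockDiag W₁ A B i j =
    if does (i <? W₁)
    then (if does (j <? W₁) then A i j else nothing)
    else (if does (j <? W₁) then nothing else B (i ∸ W₁) (j ∸ W₁))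

  module _ (W₁ W₂ : ℕ) (A B : Matrix) where

    mulVec-blockDiag-low : ∀ v {i} → i < W₁ → mulVec (W₁ + W₂) (blockDiag W₁ A B) v i ≋ mulVec W₁ A v i
    mulVec-blockDiag-low v {i} i<W₁ = begin
      mulVec (W₁ + W₂) (blockDiag W₁ A B) v i
        ≈⟨ ∑<-+ W₁ W₂ _ ⟩
      mulVec W₁ (blockDiag W₁ A B) v i +ₚ ∑< W₂ (λ j → entry (blockDiag W₁ A B i (W₁ + j)) *ₚ v (W₁ + j))
        ≈⟨ +ₚ-cong (∑<-cong W₁ λ j<W₁ → ≡⇒≋ (cong (λ e → entry e *ₚ _) (low-low j<W₁)))
                   (∑<-zero W₂ λ _ → ≡⇒≋ (cong (λ e → entry e *ₚ _) low-high)) ⟩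
      mulVec W₁ A v i +ₚ 0ₚ
        ≈⟨ +ₚ-identityʳ _ ⟩
      mulVec W₁ A v i ∎
      where
      open ≋-Reasoning
      low-low : ∀ {j} → j < W₁ → blockDiag W₁ A B i j ≡ A i j
      low-low {j} j<W₁ rewrite dec-true (i <? W₁) i<W₁ | dec-true (j <? W₁) j<W₁ = refl
      low-high : ∀ {j} → blockDiag W₁ A B i (W₁ + j) ≡ nothing
      low-high {j} rewrite dec-true (i <? W₁) i<W₁ | dec-false (W₁ + j <? W₁) (ℕₚ.m+n≮m W₁ j) = refl

    mulVec-blockDiag-high : ∀ v i → mulVec (W₁ + W₂) (blockDiag W₁ A B) v (W₁ + i) ≋ mulVec W₂ B (λ j → v (W₁ + j)) i
    mulVec-blockDiag-high v i = begin
      mulVec (W₁ + W₂) (blockDiag W₁ A B) v (W₁ + i)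
        ≈⟨ ∑<-+ W₁ W₂ _ ⟩
      mulVec W₁ (blockDiag W₁ A B) v (W₁ + i)
        +ₚ ∑< W₂ (λ j → entry (blockDiag W₁ A B (W₁ + i) (W₁ + j)) *ₚ v (W₁ + j))
        ≈⟨ +ₚ-cong (∑<-zero W₁ λ j<W₁ → ≡⇒≋ (cong (λ e → entry e *ₚ _) (high-low j<W₁)))
                   (∑<-cong W₂ λ _ → ≡⇒≋ (cong (λ e → entry e *ₚ _) high-high)) ⟩
      0ₚ +ₚ mulVec W₂ B (λ j → v (W₁ + j)) i ∎
      where
      open ≋-Reasoning
      high-low : ∀ {j} → j < W₁ → blockDiag W₁ A B (W₁ + i) j ≡ nothing
      high-low {j} j<W₁ rewrite dec-false (W₁ + i <? W₁) (ℕₚ.m+n≮m W₁ i) | dec-true (j <? W₁) j<W₁ = refl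
      high-high : ∀ {j} → blockDiag W₁ A B (W₁ + i) (W₁ + j) ≡ B i j
      high-high {j} rewrite dec-false (W₁ + i <? W₁) (ℕₚ.m+n≮m W₁ i) | dec-false (W₁ + j <? W₁) (ℕₚ.m+n≮m W₁ j)
                          | ℕₚ.m+n∸m≡n W₁ i | ℕₚ.m+n∸m≡n W₁ j = refl

  padʳ : ℕ → Matrix → Matrix
  padʳ W₁ A = blockDiag W₁ A idMatrix

  padˡ : ℕ → Matrix → Matrix
  padˡ W₁ B = blockDiag W₁ idMatrix B

  module _ (W₁ W₂ : ℕ) where

    mulVecs-padʳ-low : ∀ As v {i} → i < W₁ → mulVecs (W₁ + W₂) (map (padʳ W₁) As) v i ≋ mulVecs W₁ As v i
    mulVecs-padʳ-low []       v i<W₁ = ≋-refl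
    mulVecs-padʳ-low (A ∷ As) v i<W₁ =
      ≋-trans (mulVec-blockDiag-low W₁ W₂ A idMatrix _ i<W₁) (mulVec-cong W₁ A (mulVecs-padʳ-low As v) _)

    mulVecs-padʳ-high : ∀ As v {i} → i < W₂ → mulVecs (W₁ + W₂) (map (padʳ W₁) As) v (W₁ + i) ≋ v (W₁ + i)
    mulVecs-padʳ-high []       v i<W₂ = ≋-refl
    mulVecs-padʳ-high (A ∷ As) v i<W₂ = ≋-trans (mulVec-blockDiag-high W₁ W₂ A idMatrix _ _)
      (≋-trans (mulVec-idMatrix W₂ _ i<W₂) (mulVecs-padʳ-high As v i<W₂))

    mulVecs-padˡ-low : ∀ Bs v {i} → i < W₁ → mulVecs (W₁ + W₂) (map (padˡ W₁) Bs) v i ≋ v i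
    mulVecs-padˡ-low []       v i<W₁ = ≋-refl
    mulVecs-padˡ-low (B ∷ Bs) v i<W₁ = ≋-trans (mulVec-blockDiag-low W₁ W₂ idMatrix B _ i<W₁)
      (≋-trans (mulVec-idMatrix W₁ _ i<W₁) (mulVecs-padˡ-low Bs v i<W₁))

    mulVecs-padˡ-high : ∀ Bs v i →
      mulVecs (W₁ + W₂) (map (padˡ W₁) Bs) v (W₁ + i) ≋ mulVecs W₂ Bs (λ j → v (W₁ + j)) i
    mulVecs-padˡ-high []       v i = ≋-refl
    mulVecs-padˡ-high (B ∷ Bs) v i =
      ≋-trans (mulVec-blockDiag-high W₁ W₂ idMatrix B _ i) (mulVec-cong W₂ B (λ {j} _ → mulVecs-padˡ-high Bs v j) i)

  unitMatrix : ℕ → ℕ → Matrix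
  unitMatrix a b i j = if does (i ≟ a) ∧ does (j ≟ b) then just one else nothing

  mulVec-unitMatrix-row : ∀ W a {b} v → b < W → mulVec W (unitMatrix a b) v a ≋ v b
  mulVec-unitMatrix-row W a {b} v b<W = ≋-trans (∑<-single b b<W off) on
    where
    on : entry (unitMatrix a b a b) *ₚ v b ≋ v b
    on rewrite dec-true (a ≟ a) refl | dec-true (b ≟ b) refl = *ₚ-identityˡ (v b)
    off : ∀ {j} → j < W → j ≢ b → entry (unitMatrix a b a j) *ₚ v j ≋ 0ₚ
    off {j} _ j≢b rewrite dec-true (a ≟ a) refl | dec-false (j ≟ b) j≢b = ≋-refl

  mulVec-unitMatrix-other : ∀ W a b v {i} → i ≢ a → mulVec W (unitMatrix a b) v i ≋ 0ₚ
  mulVec-unitMatrix-other W a b v {i} i≢a = ∑<-zero W λ {j} _ → ≡⇒≋ (cong (λ e → entry e *ₚ v j) (off j))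
    where
    off : ∀ j → unitMatrix a b i j ≡ nothing
    off j rewrite dec-false (i ≟ a) i≢a = refl

  splitMatrix : ℕ → Matrix
  splitMatrix W₁ i j = if does (i ≟ 0) ∧ (does (j ≟ 0) ∨ does (j ≟ W₁)) then just one else nothing

  mergeMatrix : ℕ → Matrix
  mergeMatrix W₁ i j = splitMatrix W₁ j i

  module _ (W₁ : ℕ) where

    splitMatrix-hit : ∀ {j} → j ≡ 0 ⊎ j ≡ W₁ → ∀ p → entry (splitMatrix W₁ 0 j) *ₚ p ≋ p
    splitMatrix-hit (inj₁ refl) p = *ₚ-identityˡ p
    splitMatrix-hit (inj₂ refl) p rewrite dec-true (W₁ ≟ W₁) refl | ∨-zeroʳ (does (W₁ ≟ 0)) = *ₚ-identityˡ p

    splitMatrix-miss : ∀ {j} → j ≢ 0 → j ≢ W₁ → ∀ p → entry (splitMatrix W₁ 0 j) *ₚ p ≋ 0ₚ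
    splitMatrix-miss {j} j≢0 j≢W₁ p rewrite dec-false (j ≟ 0) j≢0 | dec-false (j ≟ W₁) j≢W₁ = ≋-refl

  mulVec-splitMatrix : ∀ W₁ W₂ v → 0 < W₁ → 0 < W₂ → mulVec (W₁ + W₂) (splitMatrix W₁) v 0 ≋ v 0 +ₚ v (W₁ + 0)
  mulVec-splitMatrix W₁ W₂ v 0<W₁ 0<W₂ = begin
    mulVec (W₁ + W₂) (splitMatrix W₁) v 0
      ≈⟨ ∑<-+ W₁ W₂ _ ⟩
    ∑< W₁ (λ j → entry (splitMatrix W₁ 0 j) *ₚ v j)
      +ₚ ∑< W₂ (λ j → entry (splitMatrix W₁ 0 (W₁ + j)) *ₚ v (W₁ + j))
      ≈⟨ +ₚ-cong (∑<-single 0 0<W₁ λ j<W₁ j≢0 → splitMatrix-miss W₁ j≢0 (ℕₚ.<⇒≢ j<W₁) _)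
                 (∑<-single 0 0<W₂ λ _ j≢0 → splitMatrix-miss W₁ (m>0⇒m+n≢0 0<W₁) (n≢0⇒m+n≢m j≢0) _) ⟩
    (entry (splitMatrix W₁ 0 0) *ₚ v 0) +ₚ (entry (splitMatrix W₁ 0 (W₁ + 0)) *ₚ v (W₁ + 0))
      ≈⟨ +ₚ-cong (splitMatrix-hit W₁ (inj₁ refl) (v 0)) (splitMatrix-hit W₁ (inj₂ (ℕₚ.+-identityʳ W₁)) _) ⟩
    v 0 +ₚ v (W₁ + 0) ∎
    where open ≋-Reasoning

  module _ (W₁ W₂ : ℕ) (q : NCPoly) (0<W₁ : 0 < W₁) where

    0<W₁+W₂ : 0 < W₁ + W₂
    0<W₁+W₂ = ℕₚ.<-≤-trans 0<W₁ (ℕₚ.m≤m+n W₁ W₂)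

    mulVec-mergeMatrix-low : ∀ {j} → j < W₁ → mulVec (W₁ + W₂) (mergeMatrix W₁) (e₀ q) j ≋ e₀ q j
    mulVec-mergeMatrix-low {j} j<W₁ = ≋-trans (mulVec-e₀ (W₁ + W₂) (mergeMatrix W₁) q j 0<W₁+W₂) (column j j<W₁)
      where
      column : ∀ j → j < W₁ → entry (splitMatrix W₁ 0 j) *ₚ q ≋ e₀ q j
      column zero    _     = splitMatrix-hit W₁ (inj₁ refl) q
      column (suc j) j<W₁ = splitMatrix-miss W₁ ℕₚ.1+n≢0 (ℕₚ.<⇒≢ j<W₁) q

    mulVec-mergeMatrix-high : ∀ j → mulVec (W₁ + W₂) (mergeMatrix W₁) (e₀ q) (W₁ + j) ≋ e₀ q j
    mulVec-mergeMatrix-high j = ≋-trans (mulVec-e₀ (W₁ + W₂) (mergeMatrix W₁) q (W₁ + j) 0<W₁+W₂) (column j)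
      where
      column : ∀ j → entry (splitMatrix W₁ 0 (W₁ + j)) *ₚ q ≋ e₀ q j
      column zero    = splitMatrix-hit W₁ (inj₂ (ℕₚ.+-identityʳ W₁)) q
      column (suc j) = splitMatrix-miss W₁ (m>0⇒m+n≢0 0<W₁) (n≢0⇒m+n≢m ℕₚ.1+n≢0) q

  -- 1 × 1 programs, so only the (0 , 0) entries matter; the second layer gives every program at least
  -- the two layers that the graph construction needs.
  leafLayers : Label → List Matrix
  leafLayers l = (λ _ _ → just l) ∷ (λ _ _ → just one) ∷ []

  width : Formula → ℕ
  width (var _) = 1
  width (cst _) = 1
  width (φ ⊕ ψ) = width φ + width ψ
  width (φ ⊗ ψ) = width φ + width ψ

  layers : Formula → List Matrix
  layers (var i) = leafLayers (lvar i)
  layers (cst a) = leafLayers (lcst a)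
  layers (φ ⊕ ψ) =
    splitMatrix (width φ) ∷ map (padʳ (width φ)) (layers φ) ++ map (padˡ (width φ)) (layers ψ)
    ++ mergeMatrix (width φ) ∷ []
  layers (φ ⊗ ψ) =
    map (padʳ (width φ)) (layers φ) ++ unitMatrix 0 (width φ) ∷ map (padˡ (width φ)) (layers ψ)
    ++ unitMatrix (width φ) 0 ∷ []

  0<width : ∀ Φ → 0 < width Φ
  0<width (var _) = s≤s z≤n
  0<width (cst _) = s≤s z≤n
  0<width (φ ⊕ ψ) = ℕₚ.<-≤-trans (0<width φ) (ℕₚ.m≤m+n _ _)
  0<width (φ ⊗ ψ) = ℕₚ.<-≤-trans (0<width φ) (ℕₚ.m≤m+n _ _)

  -- Stated for every right factor q, as the product case needs.
  ProgramComputes : Formula → Set (c ⊔ ℓ)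
  ProgramComputes Φ = ∀ q → mulVecs (width Φ) (layers Φ) (e₀ q) 0 ≋ eval Φ *ₚ q

  leafLayers-computes : ∀ l q → mulVecs 1 (leafLayers l) (e₀ q) 0 ≋ labelPoly l *ₚ q
  leafLayers-computes l q =
    ≋-trans (+ₚ-identityʳ _) (*ₚ-congˡ (labelPoly l) (≋-trans (+ₚ-identityʳ _) (*ₚ-identityˡ q)))

  layers-⊕ : ∀ φ ψ → ProgramComputes φ → ProgramComputes ψ → ProgramComputes (φ ⊕ ψ)
  layers-⊕ φ ψ φ-computes ψ-computes q = begin
    mulVec W (splitMatrix W₁) (mulVecs W (map (padʳ W₁) A ++ map (padˡ W₁) B ++ mergeMatrix W₁ ∷ []) (e₀ q)) 0
      ≡⟨ cong (λ x → mulVec W (splitMatrix W₁) x 0)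
           (trans (mulVecs-++ W (map (padʳ W₁) A) _ (e₀ q))
                  (cong (mulVecs W (map (padʳ W₁) A)) (mulVecs-++ W (map (padˡ W₁) B) _ (e₀ q)))) ⟩
    mulVec W (splitMatrix W₁) X 0
      ≈⟨ mulVec-splitMatrix W₁ W₂ X (0<width φ) (0<width ψ) ⟩
    X 0 +ₚ X (W₁ + 0)
      ≈⟨ +ₚ-cong (mulVecs-padʳ-low W₁ W₂ A Y (0<width φ)) (mulVecs-padʳ-high W₁ W₂ A Y (0<width ψ)) ⟩
    mulVecs W₁ A Y 0 +ₚ Y (W₁ + 0)
      ≈⟨ +ₚ-cong (mulVecs-cong W₁ A Y-low (0<width φ)) (mulVecs-padˡ-high W₁ W₂ B Z 0) ⟩
    mulVecs W₁ A (e₀ q) 0 +ₚ mulVecs W₂ B (λ j → Z (W₁ + j)) 0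
      ≈⟨ +ₚ-cong (φ-computes q)
                 (mulVecs-cong W₂ B (λ {j} _ → mulVec-mergeMatrix-high W₁ W₂ q (0<width φ) j) (0<width ψ)) ⟩
    (eval φ *ₚ q) +ₚ mulVecs W₂ B (e₀ q) 0
      ≈⟨ +ₚ-cong ≋-refl (ψ-computes q) ⟩
    (eval φ *ₚ q) +ₚ (eval ψ *ₚ q)
      ≡⟨ *ₚ-distribʳ (eval φ) (eval ψ) q ⟨
    (eval φ +ₚ eval ψ) *ₚ q ∎
    where
    open ≋-Reasoning
    W₁ W₂ W : ℕ
    W₁ = width φ
    W₂ = width ψ
    W = W₁ + W₂
    A B : List Matrix
    A = layers φ
    B = layers ψ
    X Y Z : ℕ → NCPoly
    Z = mulVec W (mergeMatrix W₁) (e₀ q)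
    Y = mulVecs W (map (padˡ W₁) B) Z
    X = mulVecs W (map (padʳ W₁) A) Y
    Y-low : ∀ {j} → j < W₁ → Y j ≋ e₀ q j
    Y-low j<W₁ = ≋-trans (mulVecs-padˡ-low W₁ W₂ B Z j<W₁) (mulVec-mergeMatrix-low W₁ W₂ q (0<width φ) j<W₁)

  layers-⊗ : ∀ φ ψ → ProgramComputes φ → ProgramComputes ψ → ProgramComputes (φ ⊗ ψ)
  layers-⊗ φ ψ φ-computes ψ-computes q = begin
    mulVecs W (map (padʳ W₁) A ++ unitMatrix 0 W₁ ∷ map (padˡ W₁) B ++ unitMatrix W₁ 0 ∷ []) (e₀ q) 0
      ≡⟨ cong (λ x → x 0) (trans (mulVecs-++ W (map (padʳ W₁) A) _ (e₀ q))
           (cong (mulVecs W (map (padʳ W₁) A) ∘ mulVec W (unitMatrix 0 W₁)) (mulVecs-++ W (map (padˡ W₁) B) _ (e₀ q)))) ⟩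
    mulVecs W (map (padʳ W₁) A) Y 0
      ≈⟨ mulVecs-padʳ-low W₁ W₂ A Y (0<width φ) ⟩
    mulVecs W₁ A Y 0
      ≈⟨ mulVecs-cong W₁ A Y-low (0<width φ) ⟩
    mulVecs W₁ A (e₀ (eval ψ *ₚ q)) 0
      ≈⟨ φ-computes (eval ψ *ₚ q) ⟩
    eval φ *ₚ (eval ψ *ₚ q)
      ≈⟨ *ₚ-assoc (eval φ) (eval ψ) q ⟨
    (eval φ *ₚ eval ψ) *ₚ q ∎
    where
    open ≋-Reasoning
    W₁ W₂ W : ℕ
    W₁ = width φ
    W₂ = width ψ
    W = W₁ + W₂
    A B : List Matrix
    A = layers φ
    B = layers ψ
    Y Z U : ℕ → NCPoly
    U = mulVec W (unitMatrix W₁ 0) (e₀ q)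
    Z = mulVecs W (map (padˡ W₁) B) U
    Y = mulVec W (unitMatrix 0 W₁) Z
    U-high : ∀ {j} → j < W₂ → U (W₁ + j) ≋ e₀ q j
    U-high {zero}  _ = ≋-trans (≡⇒≋ (cong U (ℕₚ.+-identityʳ W₁)))
                               (mulVec-unitMatrix-row W W₁ (e₀ q) (ℕₚ.<-≤-trans (0<width φ) (ℕₚ.m≤m+n W₁ W₂)))
    U-high {suc j} _ = mulVec-unitMatrix-other W W₁ 0 (e₀ q) (n≢0⇒m+n≢m ℕₚ.1+n≢0)
    Y-low : ∀ {j} → j < W₁ → Y j ≋ e₀ (eval ψ *ₚ q) j
    Y-low {zero}  _ = begin
      Y 0                                   ≈⟨ mulVec-unitMatrix-row W 0 Z (ℕₚ.m<m+n W₁ (0<width ψ)) ⟩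
      Z W₁                                  ≡⟨ cong Z (ℕₚ.+-identityʳ W₁) ⟨
      Z (W₁ + 0)                            ≈⟨ mulVecs-padˡ-high W₁ W₂ B U 0 ⟩
      mulVecs W₂ B (λ j → U (W₁ + j)) 0     ≈⟨ mulVecs-cong W₂ B U-high (0<width ψ) ⟩
      mulVecs W₂ B (e₀ q) 0                 ≈⟨ ψ-computes q ⟩
      eval ψ *ₚ q                           ∎
    Y-low {suc j} _ = mulVec-unitMatrix-other W 0 W₁ Z {suc j} ℕₚ.1+n≢0

  layers-computes : ∀ Φ → ProgramComputes Φ
  layers-computes (var i) = leafLayers-computes (lvar i)
  layers-computes (cst a) = leafLayers-computes (lcst a)
  layers-computes (φ ⊕ ψ) = layers-⊕ φ ψ (layers-computes φ) (layers-computes ψ)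
  layers-computes (φ ⊗ ψ) = layers-⊗ φ ψ (layers-computes φ) (layers-computes ψ)

  0<size : ∀ Φ → 0 < size Φ
  0<size (var _) = s≤s z≤n
  0<size (cst _) = s≤s z≤n
  0<size (_ ⊕ _) = s≤s z≤n
  0<size (_ ⊗ _) = s≤s z≤n

  width≤size : ∀ Φ → width Φ ≤ size Φ
  width≤size (var _) = ℕₚ.≤-refl
  width≤size (cst _) = ℕₚ.≤-refl
  width≤size (φ ⊕ ψ) = ℕₚ.m≤n⇒m≤1+n (ℕₚ.+-mono-≤ (width≤size φ) (width≤size ψ))
  width≤size (φ ⊗ ψ) = ℕₚ.m≤n⇒m≤1+n (ℕₚ.+-mono-≤ (width≤size φ) (width≤size ψ))

  length-layers : ∀ Φ → length (layers Φ) ≡ 2 * size Φ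
  length-layers (var _) = refl
  length-layers (cst _) = refl
  length-layers (φ ⊕ ψ) = trans
    (cong suc (length-map++map∷ʳ (padʳ (width φ)) (padˡ (width φ)) (mergeMatrix (width φ)) (layers φ) (layers ψ)))
    (2+[a+b]≡2[1+s+t] (size φ) (size ψ) (length-layers φ) (length-layers ψ))
  length-layers (φ ⊗ ψ) = trans
    (Listₚ.length-++-sucʳ (map (padʳ (width φ)) (layers φ)) (unitMatrix 0 (width φ)) _)
    (trans (cong suc (length-map++map∷ʳ (padʳ (width φ)) (padˡ (width φ)) (unitMatrix (width φ) 0) (layers φ) (layers ψ)))
           (2+[a+b]≡2[1+s+t] (size φ) (size ψ) (length-layers φ) (length-layers ψ)))

  -- The layered cycle graph of a branching program

  weight≡entry : ∀ {N} (G : Graph N) x y → weight G x y ≡ entry (G x y)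
  weight≡entry G x y with G x y
  ... | just _  = refl
  ... | nothing = refl

  module LayeredGraph (W′ : ℕ) (Ms : List Matrix) (2≤L : 2 ≤ length Ms) where

    W L : ℕ
    W = suc W′
    L = length Ms

    mat : ℕ → Matrix
    mat = lookupOr (λ _ _ → nothing) Ms

    next : ℕ → ℕ
    next p = if does (suc p <? W) then suc p else 0

    next-< : ∀ {p} → suc p < W → next p ≡ suc p
    next-< {p} 1+p<W rewrite dec-true (suc p <? W) 1+p<W = refl

    next-≮ : ∀ {p} → ¬ suc p < W → next p ≡ 0
    next-≮ {p} 1+p≮W rewrite dec-false (suc p <? W) 1+p≮W = refl

    next-last : next W′ ≡ 0
    next-last = next-≮ (ℕₚ.n≮n W)

    next-injective : ∀ {a b} → a < W → b < W → next a ≡ next b → a ≡ b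
    next-injective {a} {b} a<W b<W eq with suc a <? W | suc b <? W
    ... | yes a+1<W | yes b+1<W = ℕₚ.suc-injective (trans (sym (next-< a+1<W)) (trans eq (next-< b+1<W)))
    ... | yes a+1<W | no b+1≮W  = ⊥-elim (ℕₚ.1+n≢0 (trans (sym (next-< a+1<W)) (trans eq (next-≮ b+1≮W))))
    ... | no a+1≮W  | yes b+1<W = ⊥-elim (ℕₚ.1+n≢0 (trans (sym (next-< b+1<W)) (trans (sym eq) (next-≮ a+1≮W))))
    ... | no a+1≮W  | no b+1≮W  = ℕₚ.suc-injective (trans (is-last a<W a+1≮W) (sym (is-last b<W b+1≮W)))
      where
      is-last : ∀ {c} → c < W → ¬ suc c < W → suc c ≡ W
      is-last c<W c+1≮W = ℕₚ.≤-antisym c<W (ℕₚ.≮⇒≥ c+1≮W)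

    -- Layer l is the cycle (l , 0) → (l , 1) → ⋯ → (l , W′) → (l , 0) of weight-1 edges (without a loop
    -- when W = 1). An edge leaving the layer from position p reads row next p of the l-th matrix: a
    -- Hamiltonian cycle that entered the layer at k leaves it from the predecessor of k.
    edge : ℕ × ℕ → ℕ × ℕ → Maybe Label
    edge (l , p) (l′ , q) =
      if does (l ≟ l′) then (if does (q ≟ next p) ∧ not (does (p ≟ q)) then just one else nothing)
      else if does (l′ ≟ suc l) then mat l (next p) q
      else if does (suc l ≟ L) ∧ does (l′ ≟ 0) ∧ does (q ≟ 0) then mat l (next p) 0
      else nothing

    wt : ℕ × ℕ → ℕ × ℕ → NCPoly
    wt u v = entry (edge u v)

    open Paths wt (0 , 0)

    wt-next : ∀ l {p} → p ≢ next p → wt (l , p) (l , next p) ≡ 1ₚ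
    wt-next l {p} p≢next
      rewrite dec-true (l ≟ l) refl | dec-true (next p ≟ next p) refl | dec-false (p ≟ next p) p≢next = refl

    wt-within : ∀ l {p q} → q ≢ next p ⊎ p ≡ q → wt (l , p) (l , q) ≡ 0ₚ
    wt-within l {p} {q} (inj₁ q≢next) rewrite dec-true (l ≟ l) refl | dec-false (q ≟ next p) q≢next = refl
    wt-within l {p}     (inj₂ refl)
      rewrite dec-true (l ≟ l) refl | dec-true (p ≟ p) refl | ∧-zeroʳ (does (p ≟ next p)) = refl

    wt-down : ∀ l p q → wt (l , p) (suc l , q) ≡ entry (mat l (next p) q)
    wt-down l p q rewrite dec-false (l ≟ suc l) (ℕₚ.<⇒≢ (ℕₚ.n<1+n l)) | dec-true (suc l ≟ suc l) refl = refl

    last-layer≢0 : ∀ {l} → suc l ≡ L → l ≢ 0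
    last-layer≢0 1+l≡L refl = ℕₚ.1+n≰n (subst (2 ≤_) (sym 1+l≡L) 2≤L)

    wt-wrap : ∀ {l} p → suc l ≡ L → wt (l , p) (0 , 0) ≡ entry (mat l (next p) 0)
    wt-wrap {l} p 1+l≡L
      rewrite dec-false (l ≟ 0) (last-layer≢0 1+l≡L) | dec-false (0 ≟ suc l) (ℕₚ.1+n≢0 ∘ sym)
            | dec-true (suc l ≟ L) 1+l≡L = refl

    wt-none : ∀ {l p l′ q} → l ≢ l′ → l′ ≢ suc l → ¬ (suc l ≡ L × l′ ≡ 0 × q ≡ 0) →
              wt (l , p) (l′ , q) ≡ 0ₚ
    wt-none {l} {p} {l′} {q} l≢l′ l′≢1+l no-wrap
      rewrite dec-false (l ≟ l′) l≢l′ | dec-false (l′ ≟ suc l) l′≢1+l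
            | dec-false ((suc l ≟ L) ×-dec (l′ ≟ 0) ×-dec (q ≟ 0)) no-wrap = refl

    -- The positions of a layer other than k, in the cyclic order in which a Hamiltonian cycle entering
    -- the layer at k must visit them.
    around : ℕ → List ℕ
    around k = range (suc k) (W′ ∸ k) ++ range 0 k

    data Successive : ℕ → List ℕ → Set where
      []  : ∀ {a} → Successive a []
      _∷_ : ∀ {a x xs} → x ≡ next a → Successive x xs → Successive a (x ∷ xs)

    successive-++ : ∀ {a} xs {ys} → Successive a xs → Successive (lastOr a xs) ys → Successive a (xs ++ ys)
    successive-++ []       []         succ = succ
    successive-++ (x ∷ xs) (x≡ ∷ succ) succ′ = x≡ ∷ successive-++ xs succ succ′

    successive-range : ∀ a m → a + m < W → Successive a (range (suc a) m)
    successive-range a zero    _       = []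
    successive-range a (suc m) a+m+1<W =
      sym (next-< (ℕₚ.≤-<-trans (s≤s (ℕₚ.m≤m+n a m)) a+1+m<W)) ∷ successive-range (suc a) m a+1+m<W
      where
      a+1+m<W : suc a + m < W
      a+1+m<W = subst (_< W) (ℕₚ.+-suc a m) a+m+1<W

    module _ {k} (k<W : k < W) where

      k+[W′∸k]≡W′ : k + (W′ ∸ k) ≡ W′
      k+[W′∸k]≡W′ = ℕₚ.m+[n∸m]≡n (ℕₚ.≤-pred k<W)

      around-↭ : k ∷ around k ↭ range 0 W
      around-↭ = ↭-trans (++-comm (k ∷ range (suc k) (W′ ∸ k)) (range 0 k)) (↭-reflexive (sym (begin
        range 0 W                                      ≡⟨ cong (range 0) (trans (ℕₚ.+-suc k _) (cong suc k+[W′∸k]≡W′)) ⟨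
        range 0 (k + suc (W′ ∸ k))                     ≡⟨ range-++ 0 k (suc (W′ ∸ k)) ⟩
        range 0 k ++ k ∷ range (suc k) (W′ ∸ k)        ∎)))
        where open ≡-Reasoning

      around-unique : AllPairs _≢_ (k ∷ around k)
      around-unique = Unique-resp-↭ (↭⇒↭ₛ (↭-sym around-↭)) (range-unique 0 W)

      around-< : All (_< W) (around k)
      around-< = All.tail (All-resp-↭ (↭-sym around-↭) (range-All 0 W λ _ j<W → j<W))

      lastOr-first-run : lastOr k (range (suc k) (W′ ∸ k)) ≡ W′
      lastOr-first-run = trans (lastOr-range k (W′ ∸ k)) k+[W′∸k]≡W′

      around-successive : Successive k (around k)
      around-successive = successive-++ (range (suc k) (W′ ∸ k))
        (successive-range k (W′ ∸ k) (subst (_< W) (sym k+[W′∸k]≡W′) (ℕₚ.n<1+n W′)))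
        (subst (λ a → Successive a (range 0 k)) (sym lastOr-first-run) (wrap-around k k<W))
        where
        wrap-around : ∀ j → j < W → Successive W′ (range 0 j)
        wrap-around zero    _     = []
        wrap-around (suc j) j+1<W = sym next-last ∷ successive-range 0 j (ℕₚ.<⇒≤ j+1<W)

      next-lastOr-around : next (lastOr k (around k)) ≡ k
      next-lastOr-around = begin
        next (lastOr k (around k))
          ≡⟨ cong next (lastOr-++ k (range (suc k) (W′ ∸ k)) (range 0 k)) ⟩
        next (lastOr (lastOr k (range (suc k) (W′ ∸ k))) (range 0 k))
          ≡⟨ cong (λ a → next (lastOr a (range 0 k))) lastOr-first-run ⟩
        next (lastOr W′ (range 0 k))
          ≡⟨ wrap-around k k<W ⟩
        k ∎
        where
        open ≡-Reasoning
        wrap-around : ∀ j → j < W → next (lastOr W′ (range 0 j)) ≡ j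
        wrap-around zero    _     = next-last
        wrap-around (suc j) j+1<W = trans (cong next (lastOr-range 0 j)) (next-< j+1<W)

    layer : ℕ → List (ℕ × ℕ)
    layer l = map (l ,_) (range 0 W)

    layersFrom : ℕ → ℕ → List (ℕ × ℕ)
    layersFrom l m = concatMap layer (range l m)

    layersFrom-All : ∀ l m → All (λ (l′ , _) → l ≤ l′) (layersFrom l m)
    layersFrom-All l zero    = []
    layersFrom-All l (suc m) =
      Allₚ.++⁺ (Allₚ.map⁺ (range-All 0 W λ _ _ → ℕₚ.≤-refl)) (All.map ℕₚ.<⇒≤ (layersFrom-All (suc l) m))

    length-layer : ∀ {l} → length (layer l) ≡ W
    length-layer {l} = trans (Listₚ.length-map (l ,_) (range 0 W)) (length-range 0 W)

    length-layersFrom : ∀ l m → length (layersFrom l m) ≡ m * W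
    length-layersFrom l zero    = refl
    length-layersFrom l (suc m) = begin
      length (layer l ++ layersFrom (suc l) m)        ≡⟨ Listₚ.length-++ (layer l) ⟩
      length (layer l) + length (layersFrom (suc l) m) ≡⟨ cong₂ _+_ length-layer (length-layersFrom (suc l) m) ⟩
      W + m * W                                        ∎
      where open ≡-Reasoning

    -- Inside layer l the only edge into (l , x) is the cycle edge from its predecessor: the other
    -- positions are distinct from it, and later layers only reach back to (0 , 0).
    layer-forcedPath : ∀ l {a} xs → a < W → Successive a xs → AllPairs _≢_ (a ∷ xs) → All (_< W) xs →
      (l ≡ 0 → All (0 ≢_) xs) → ∀ R → All (λ (l′ , _) → l < l′) R → ForcedPath (l , a) (map (l ,_) xs) R
    layer-forcedPath l []       _ _ _ _ _ R _ = []
    layer-forcedPath l {a} (x ∷ xs) a<W (x≡next ∷ succ) ((a≢x ∷ a∉xs) ∷ unique) (x<W ∷ xs<W) nonzero R R-later =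
      (enter , wt-within l (inj₂ refl) ∷ Allₚ.++⁺ (Allₚ.map⁺ (All.zipWith from-layer (a∉xs , xs<W)))
                                                  (All.map from-later R-later))
      ∷ layer-forcedPath l xs x<W succ unique xs<W (All.tail ∘ nonzero) R R-later
      where
      enter : wt (l , a) (l , x) ≡ 1ₚ
      enter rewrite x≡next = wt-next l a≢x
      from-layer : ∀ {b} → a ≢ b × b < W → wt (l , b) (l , x) ≡ 0ₚ
      from-layer (a≢b , b<W) =
        wt-within l (inj₁ λ x≡next-b → a≢b (next-injective a<W b<W (trans (sym x≡next) x≡next-b)))
      from-later : ∀ {z} → l < proj₁ z → wt z (l , x) ≡ 0ₚ
      from-later l<l′ = wt-none (ℕₚ.>⇒≢ l<l′) (ℕₚ.<⇒≢ (ℕₚ.<-trans l<l′ (ℕₚ.n<1+n _)))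
                                (λ (_ , l≡0 , x≡0) → All.head (nonzero l≡0) (sym x≡0))

    pathSum-entering-layer : ∀ u l′ R → All (λ z → wt u z ≡ 0ₚ) R →
      pathSum u (layer l′ ++ R) ≋ ∑< W (λ j → wt u (l′ , j) *ₚ pathSum (l′ , j) (map (l′ ,_) (around j) ++ R))
    pathSum-entering-layer u l′ R R-unreachable = begin
      pathSum u (layer l′ ++ R)
        ≈⟨ pathSum-by-first u (l′ , 0) (map (l′ ,_) (range 1 W′) ++ R) rest
             (Allₚ.++⁺ (Allₚ.map⁺ (range-All 0 W λ _ j<W → inj₂ (enters j<W))) (All.map inj₁ R-unreachable)) ⟩
      sumₚ (map step (layer l′ ++ R))
        ≡⟨ trans (cong sumₚ (Listₚ.map-++ step (layer l′) R)) (sumₚ-++ (map step (layer l′)) (map step R)) ⟩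
      sumₚ (map step (layer l′)) +ₚ sumₚ (map step R)
        ≈⟨ +ₚ-cong ≋-refl (sum-map-zero R (All.map (λ {z} wuz → ≡⇒≋ (cong (_*ₚ pathSum z (rest z)) wuz))
                                                   R-unreachable)) ⟩
      sumₚ (map step (layer l′)) +ₚ 0ₚ
        ≈⟨ +ₚ-identityʳ _ ⟩
      sumₚ (map step (map (l′ ,_) (range 0 W)))
        ≡⟨ cong sumₚ (Listₚ.map-∘ (range 0 W)) ⟨
      sumₚ (map (λ j → step (l′ , j)) (range 0 W))
        ≡⟨ sum-range W (λ j → step (l′ , j)) ⟩
      ∑< W (λ j → step (l′ , j)) ∎
      where
      open ≋-Reasoning
      rest : ℕ × ℕ → List (ℕ × ℕ)
      rest (_ , j) = map (l′ ,_) (around j) ++ R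
      step : ℕ × ℕ → NCPoly
      step y = wt u y *ₚ pathSum y (rest y)
      enters : ∀ {j} → j < W → (l′ , j) ∷ rest (l′ , j) ↭ layer l′ ++ R
      enters j<W = ++⁺ʳ R (map⁺ (l′ ,_) (around-↭ j<W))

    pathSum≋mulVecs : ∀ m l → suc l + m ≡ L → ∀ {k} → k < W → (l ≡ 0 → k ≡ 0) →
      pathSum (l , k) (map (l ,_) (around k) ++ layersFrom (suc l) m) ≋ mulVecs W (map mat (range l (suc m))) (e₀ 1ₚ) k
    pathSum≋mulVecs m l 1+l+m≡L {k} k<W l≡0⇒k≡0 = begin
      pathSum (l , k) (map (l ,_) (around k) ++ layersFrom (suc l) m)
        ≈⟨ pathSum-forcedPath (layer-forcedPath l (around k) k<W (around-successive k<W) (around-unique k<W) (around-< k<W)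
                                 first-layer _ (layersFrom-All (suc l) m)) ⟩
      pathSum (lastOr (l , k) (map (l ,_) (around k))) (layersFrom (suc l) m)
        ≡⟨ cong (λ v → pathSum v (layersFrom (suc l) m)) (lastOr-map (l ,_) k (around k)) ⟩
      pathSum (l , p) (layersFrom (suc l) m)
        ≈⟨ leave m 1+l+m≡L ⟩
      mulVecs W (map mat (range l (suc m))) (e₀ 1ₚ) k ∎
      where
      open ≋-Reasoning
      first-layer : l ≡ 0 → All (0 ≢_) (around k)
      first-layer l≡0 =
        subst (λ j → All (0 ≢_) (around j)) (sym (l≡0⇒k≡0 l≡0)) (AllPairs.head (around-unique (s≤s z≤n)))
      p : ℕ
      p = lastOr k (around k)
      leave : ∀ m → suc l + m ≡ L → pathSum (l , p) (layersFrom (suc l) m) ≋ mulVecs W (map mat (range l (suc m))) (e₀ 1ₚ) k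
      leave zero 1+l+0≡L = begin
        pathSum (l , p) []           ≈⟨ pathSum-[] (l , p) ⟩
        wt (l , p) (0 , 0)           ≡⟨ wt-wrap p (trans (sym (ℕₚ.+-identityʳ (suc l))) 1+l+0≡L) ⟩
        entry (mat l (next p) 0)     ≡⟨ cong (λ j → entry (mat l j 0)) (next-lastOr-around k<W) ⟩
        entry (mat l k 0)            ≈⟨ *ₚ-identityʳ _ ⟨
        entry (mat l k 0) *ₚ 1ₚ      ≈⟨ mulVec-e₀ W (mat l) 1ₚ k (s≤s z≤n) ⟨
        mulVec W (mat l) (e₀ 1ₚ) k   ∎
      leave (suc m) 1+l+1+m≡L = begin
        pathSum (l , p) (layer (suc l) ++ R)
          ≈⟨ pathSum-entering-layer (l , p) (suc l) R (All.map skipped (layersFrom-All (suc (suc l)) m)) ⟩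
        ∑< W (λ j → wt (l , p) (suc l , j) *ₚ pathSum (suc l , j) (map (suc l ,_) (around j) ++ R))
          ≈⟨ ∑<-cong W through-layer ⟩
        mulVec W (mat l) (mulVecs W (map mat (range (suc l) (suc m))) (e₀ 1ₚ)) k ∎
        where
        R : List (ℕ × ℕ)
        R = layersFrom (suc (suc l)) m
        skipped : ∀ {z} → suc (suc l) ≤ proj₁ z → wt (l , p) z ≡ 0ₚ
        skipped 2+l≤l′ =
          wt-none (ℕₚ.<⇒≢ (ℕₚ.<-trans (ℕₚ.n<1+n _) 2+l≤l′)) (ℕₚ.>⇒≢ 2+l≤l′)
                  (λ (_ , l′≡0 , _) → ℕₚ.1+n≢0 (ℕₚ.n≤0⇒n≡0 (subst (suc (suc l) ≤_) l′≡0 2+l≤l′)))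
        through-layer : ∀ {j} → j < W →
          wt (l , p) (suc l , j) *ₚ pathSum (suc l , j) (map (suc l ,_) (around j) ++ R)
            ≋ entry (mat l k j) *ₚ mulVecs W (map mat (range (suc l) (suc m))) (e₀ 1ₚ) j
        through-layer {j} j<W = begin
          wt (l , p) (suc l , j) *ₚ pathSum (suc l , j) (map (suc l ,_) (around j) ++ R)
            ≡⟨ cong (_*ₚ pathSum (suc l , j) (map (suc l ,_) (around j) ++ R))
                 (trans (wt-down l p j) (cong (λ i → entry (mat l i j)) (next-lastOr-around k<W))) ⟩
          entry (mat l k j) *ₚ pathSum (suc l , j) (map (suc l ,_) (around j) ++ R)
            ≈⟨ *ₚ-congˡ (entry (mat l k j))
                 (pathSum≋mulVecs m (suc l) (trans (sym (ℕₚ.+-suc (suc l) m)) 1+l+1+m≡L) j<W λ ()) ⟩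
          entry (mat l k j) *ₚ mulVecs W (map mat (range (suc l) (suc m))) (e₀ 1ₚ) j ∎

    others : List (ℕ × ℕ)
    others = map (0 ,_) (around 0) ++ layersFrom 1 (pred L)

    vertices : List (ℕ × ℕ)
    vertices = (0 , 0) ∷ others

    graph : Graph (suc (length others))
    graph x y = edge (List.lookup vertices x) (List.lookup vertices y)

    1+pred[L]≡L : suc (pred L) ≡ L
    1+pred[L]≡L = ℕₚ.suc-pred L ⦃ ℕ.>-nonZero (ℕₚ.<-trans (s≤s z≤n) 2≤L) ⦄

    map-mat-range : map mat (range 0 L) ≡ Ms
    map-mat-range = map-lookupOr-range (λ _ _ → nothing) Ms

    HC-graph : HC graph ≋ mulVecs W Ms (e₀ 1ₚ) 0
    HC-graph = begin
      HC graph
        ≡⟨ HC-relabel graph wt (List.lookup vertices) (weight≡entry graph) ⟩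
      pathSum (0 , 0) (map (List.lookup others) (List.allFin (length others)))
        ≡⟨ cong (pathSum (0 , 0)) (map-lookup-allFin others) ⟩
      pathSum (0 , 0) others
        ≈⟨ pathSum≋mulVecs (pred L) 0 1+pred[L]≡L (s≤s z≤n) (λ _ → refl) ⟩
      mulVecs W (map mat (range 0 (suc (pred L)))) (e₀ 1ₚ) 0
        ≡⟨ cong (λ Ns → mulVecs W Ns (e₀ 1ₚ) 0) (trans (cong (map mat ∘ range 0) 1+pred[L]≡L) map-mat-range) ⟩
      mulVecs W Ms (e₀ 1ₚ) 0 ∎
      where open ≋-Reasoning

    length-vertices : length vertices ≡ L * W
    length-vertices = begin
      length vertices                              ≡⟨ ↭-length (++⁺ʳ _ (map⁺ (0 ,_) (around-↭ (s≤s z≤n)))) ⟩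
      length (layersFrom 0 (suc (pred L)))         ≡⟨ length-layersFrom 0 (suc (pred L)) ⟩
      suc (pred L) * W                             ≡⟨ cong (_* W) 1+pred[L]≡L ⟩
      L * W                                        ∎
      where open ≡-Reasoning

  formula-to-graph : ∀ Φ → ∃ λ m → Σ (Graph (suc m)) λ G → (suc m ≤ 2 * (size Φ ^ 2)) × (eval Φ ≈ₚ HC G)
  formula-to-graph Φ = length others , graph , vertex-bound , ≋⇒≈ₚ eval≋HC
    where
    1+W′≡W : suc (pred (width Φ)) ≡ width Φ
    1+W′≡W = ℕₚ.suc-pred (width Φ) ⦃ ℕ.>-nonZero (0<width Φ) ⦄
    2≤L : 2 ≤ length (layers Φ)
    2≤L = subst (2 ≤_) (sym (length-layers Φ)) (ℕₚ.*-monoʳ-≤ 2 (0<size Φ))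
    open LayeredGraph (pred (width Φ)) (layers Φ) 2≤L
    eval≋HC : eval Φ ≋ HC graph
    eval≋HC = begin
      eval Φ                                               ≈⟨ *ₚ-identityʳ (eval Φ) ⟨
      eval Φ *ₚ 1ₚ                                         ≈⟨ layers-computes Φ 1ₚ ⟨
      mulVecs (width Φ) (layers Φ) (e₀ 1ₚ) 0               ≡⟨ cong (λ W → mulVecs W (layers Φ) (e₀ 1ₚ) 0) 1+W′≡W ⟨
      mulVecs (suc (pred (width Φ))) (layers Φ) (e₀ 1ₚ) 0  ≈⟨ HC-graph ⟨
      HC graph                                             ∎
      where open ≋-Reasoning
    vertex-bound : suc (length others) ≤ 2 * (size Φ ^ 2)
    vertex-bound = begin
      suc (length others)                       ≡⟨ length-vertices ⟩
      length (layers Φ) * suc (pred (width Φ))  ≡⟨ cong₂ _*_ (length-layers Φ) 1+W′≡W ⟩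
      2 * size Φ * width Φ                      ≤⟨ ℕₚ.*-monoʳ-≤ (2 * size Φ) (width≤size Φ) ⟩
      2 * size Φ * size Φ                       ≡⟨ solve 1 (λ s → con 2 :* s :* s := con 2 :* (s :^ 2)) refl (size Φ) ⟩
      2 * (size Φ ^ 2)                          ∎
      where
      open ℕₚ.≤-Reasoning
      open +-*-Solver

lemmaA1 : (c ℓ : Level) → ∃ λ k →
    (F : Field c ℓ) (n : ℕ) (Φ : NC.Formula F n) →
      ∃ λ m → Σ (NC.Graph F n (suc m)) λ G →
        (suc m ≤ k * (NC.size F n Φ ^ k)) × NC._≈ₚ_ F n (NC.eval F n Φ) (NC.HC F n G)
lemmaA1 c ℓ = 2 , formula-to-graph
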